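{- (i) For $n\ge2$: $\operatorname{wdim}_1(K_n)=n-1$ and $\operatorname{wdim}_2(K_n)=n$. (ii) For the star $S_n$ with $n\ge5$ vertices: $\operatorname{wdim}_k(S_n)=n-2$ for $k\in\{1,2\}$ and $\operatorname{wdim}_k(S_n)=n-1$ for $k\in\{3,4\}$. (iii) For $q,r\ge2$: $\operatorname{wdim}_k(K_{q,r})=q+r-2$ for $k\in\{1,2\}$ and $\operatorname{wdim}_k(K_{q,r})=q+r$ for $k\in\{3,4\}$. (iv) For $n\ge2$: $\operatorname{wdim}_k(P_n)=k$ for all $k\in\{1,\dots,n\}$. (v) For $n\ge5$: $\operatorname{wdim}_1(C_n)=2$; if $n$ is odd then $\operatorname{wdim}_k(C_n)=k+1$ for $k\in\{2,\dots,n-1\}$, and if $n$ is even then $\operatorname{wdim}_k(C_n)=k$ for $k\in\{2,\dots,n\}$.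
   Context: All graphs are finite, simple and connected; $d(u,v)$ is the distance. $K_n$, $S_n=K_{1,n-1}$, $K_{q,r}$, $P_n$, $C_n$ denote the complete graph, star on $n$ vertices, complete bipartite graph, path and cycle. For vertices $x,y,s$ put $\Delta_s(x,y)=|d(x,s)-d(y,s)|$, $\Delta_S(x,y)=\sum_{s\in S}\Delta_s(x,y)$. For $k\ge1$, $S\subseteq V(G)$ is a weak $k$-resolving set if $\Delta_S(x,y)\ge k$ for all distinct $x,y$; $\operatorname{wdim}_k(G)$ is the minimum cardinality of a weak $k$-resolving set. -}

module Defs where

open import Data.Nat using (ℕ; zero; suc; _+_; _∸_; _≤_; _<ᵇ_; _≡ᵇ_; ∣_-_∣)
open import Data.Bool using (Bool; true; false; _∧_; _∨_; not; if_then_else_; _xor_)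
open import Data.Fin using (Fin; toℕ; _≟_)
open import Data.Fin.Subset using (Subset; ∣_∣)
open import Data.Vec using (lookup)
open import Data.List using (List; map; allFin)
open import Data.Bool.ListAction using (any)
open import Data.Nat.ListAction using (sum)
open import Data.Product using (Σ; _×_)
open import Relation.Nullary using (¬_)
open import Relation.Nullary.Decidable using (⌊_⌋)
open import Relation.Binary.PropositionalEquality using (_≡_)

Graph : ℕ → Set
Graph n = Fin n → Fin n → Bool

reach : ∀ {n} → Graph n → ℕ → Fin n → Fin n → Bool
reach {n} G zero    u v = ⌊ u ≟ v ⌋
reach {n} G (suc m) u v = any (λ w → G u w ∧ reach G m w v) (allFin n)

distAux : ∀ {n} → Graph n → Fin n → Fin n → ℕ → ℕ → ℕ
distAux G u v zero    m = m
distAux G u v (suc f) m = if reach G m u v then m else distAux G u v f (suc m)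

-- d(u,v): the least length of a u–v walk (= shortest path length); in a
-- connected graph on n vertices this is < n, so fuel n suffices.
dist : ∀ {n} → Graph n → Fin n → Fin n → ℕ
dist {n} G u v = distAux G u v n 0

ΔS : ∀ {n} → Graph n → Subset n → Fin n → Fin n → ℕ
ΔS {n} G S x y =
  sum (map (λ s → if lookup S s then ∣ dist G x s - dist G y s ∣ else 0) (allFin n))

WeakResolving : ∀ {n} → ℕ → Graph n → Subset n → Set
WeakResolving {n} k G S = (x y : Fin n) → ¬ (x ≡ y) → k ≤ ΔS G S x y

IsWDim : ∀ {n} → ℕ → Graph n → ℕ → Set
IsWDim {n} k G m =
  Σ (Subset n) (λ S → WeakResolving k G S × ∣ S ∣ ≡ m)
  × ((S : Subset n) → WeakResolving k G S → m ≤ ∣ S ∣)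

complete : (n : ℕ) → Graph n
complete n i j = not ⌊ i ≟ j ⌋

-- star S_n = K_{1,n-1}: vertex 0 is the centre
star : (n : ℕ) → Graph n
star n i j = (toℕ i ≡ᵇ 0) xor (toℕ j ≡ᵇ 0)

completeBipartite : (q r : ℕ) → Graph (q + r)
completeBipartite q r i j = (toℕ i <ᵇ q) xor (toℕ j <ᵇ q)

path : (n : ℕ) → Graph n
path n i j = ∣ toℕ i - toℕ j ∣ ≡ᵇ 1

-- C_n: 0 - 1 - ... - (n-1) - 0   (used for n ≥ 3)
cycle : (n : ℕ) → Graph n
cycle n i j = (∣ toℕ i - toℕ j ∣ ≡ᵇ 1) ∨ (∣ toℕ i - toℕ j ∣ ≡ᵇ (n ∸ 1))

-- Each graph family has an explicit distance formula D, identified with dist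
-- through the properties collected in IsDistance, so that
-- ΔS(x, y) = Σ_{s ∈ S} |D x s − D y s|.
--
-- Twins (distinct vertices at equal distance from every other
-- vertex) can only be told apart by themselves: a weak resolving set must meet
-- every pair of twins, and when k exceeds what one twin contributes it must
-- contain every vertex that has a twin.  For an edge xy every term of ΔS(x, y)
-- is at most 1, so k ≤ |S|; on an odd cycle each s is equidistant from the
-- ends of its opposite edge, which improves this to k + 1 ≤ |S|.
--
-- Take S to be all vertices but one or two, the leaves, or an
-- initial segment of the path or cycle, and count the s ∈ S equidistant from
-- x ≠ y.  Such an s is a midpoint of x and y (modulo n on a cycle): a path and
-- an odd cycle have at most one, an even cycle at most two, which are then
-- antipodal.  For even n the parity of |D x s − D y s| is that of x + y, so
-- the nonzero terms are at least 2 when x + y is even.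

module Submission where

open import Defs
open import Data.Nat
  using (ℕ; zero; suc; _+_; _∸_; _*_; _≤_; _<_; z≤n; s≤s; _<ᵇ_; _≡ᵇ_; ∣_-_∣; _⊓_; _⊔_; pred; _≤?_; _<?_; parity)
open import Data.Nat.Properties hiding (_≟_)
open import Data.Nat.Properties using () renaming (_≟_ to _≟ℕ_)
open import Data.Nat.ListAction using (sum)
open import Data.Nat.Divisibility using (_∣_; divides; ∣-refl; ∣m∣n⇒∣m+n)
open import Data.Nat.Tactic.RingSolver using (solve-∀)
open import Algebra.Properties.CommutativeSemigroup +-commutativeSemigroup
  using (interchange; x∙yz≈y∙xz; x∙yz≈yx∙z; xy∙z≈y∙xz; xy∙z≈xz∙y)
open import Data.Parity.Base using (0ℙ; 1ℙ; _⁻¹) renaming (_+_ to _+ℙ_)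
import Data.Parity.Properties as ℙ
open import Data.Bool using (Bool; true; false; _∧_; not; if_then_else_; _xor_)
open import Data.Bool.Properties using (T-≡; ∨-zeroʳ; not-injective) renaming (_≟_ to _≟ᵇ_)
open import Data.Fin using (Fin; zero; suc; toℕ; _≟_; fromℕ<)
open import Data.Fin.Properties using (toℕ-injective; toℕ<n; toℕ-fromℕ<) renaming (suc-injective to fsuc-injective)
open import Data.Fin.Subset using (Subset; ∣_∣)
open import Data.Vec using ([]; _∷_; lookup; tabulate)
open import Data.Vec.Properties using (lookup∘tabulate)
open import Data.List using (map; allFin)
open import Data.List.Properties using (map-tabulate)
open import Data.List.Relation.Unary.Any using (satisfied)
open import Data.List.Relation.Unary.Any.Properties using (any⁺; any⁻)
open import Data.List.Membership.Propositional using (lose)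
open import Data.List.Membership.Propositional.Properties using (∈-allFin)
open import Data.Product using (∃; _×_; _,_)
open import Data.Sum using (_⊎_; inj₁; inj₂)
open import Data.Empty using (⊥)
open import Function using (_∘_; Equivalence)
open import Relation.Nullary using (¬_; Dec; yes; no; contradiction)
open import Relation.Nullary.Decidable using (⌊_⌋; dec-true; dec-false; isYes≗does)
open import Relation.Binary.Definitions using (tri<; tri≈; tri>)
open import Relation.Binary.PropositionalEquality
open Equivalence using (to; from)

-- Sums over the members of a Boolean predicate on Fin n

∑ : ∀ {n} → (Fin n → ℕ) → ℕ
∑ {zero}  f = 0
∑ {suc n} f = f zero + ∑ (f ∘ suc)

∑∈ : ∀ {n} → (Fin n → Bool) → (Fin n → ℕ) → ℕ
∑∈ P f = ∑ (λ s → if P s then f s else 0)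

count : ∀ {n} → (Fin n → Bool) → ℕ
count P = ∑∈ P (λ _ → 1)

𝟙 : ∀ {n} → (Fin n → Bool) → Fin n → ℕ
𝟙 P s = if P s then 1 else 0

_─_ : ∀ {n} → (Fin n → Bool) → Fin n → Fin n → Bool
(P ─ zero)  zero    = false
(P ─ zero)  (suc s) = P (suc s)
(P ─ suc a) zero    = P zero
(P ─ suc a) (suc s) = ((P ∘ suc) ─ a) s

sum-map-allFin : ∀ {n} (g : Fin n → ℕ) → sum (map g (allFin n)) ≡ ∑ g
sum-map-allFin {n} g = trans (cong sum (map-tabulate (λ i → i) g)) (sum-tabulate g)
  where
  sum-tabulate : ∀ {n} (g : Fin n → ℕ) → sum (Data.List.tabulate g) ≡ ∑ g
  sum-tabulate {zero}  g = refl
  sum-tabulate {suc n} g = cong (g zero +_) (sum-tabulate (g ∘ suc))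

∑-cong : ∀ {n} {f g : Fin n → ℕ} → (∀ s → f s ≡ g s) → ∑ f ≡ ∑ g
∑-cong {zero}  e = refl
∑-cong {suc n} e = cong₂ _+_ (e zero) (∑-cong (e ∘ suc))

∑-mono-≤ : ∀ {n} {f g : Fin n → ℕ} → (∀ s → f s ≤ g s) → ∑ f ≤ ∑ g
∑-mono-≤ {zero}  f≤g = z≤n
∑-mono-≤ {suc n} f≤g = +-mono-≤ (f≤g zero) (∑-mono-≤ (f≤g ∘ suc))

∑-distrib-+ : ∀ {n} (f g : Fin n → ℕ) → ∑ (λ s → f s + g s) ≡ ∑ f + ∑ g
∑-distrib-+ {zero}  f g = refl
∑-distrib-+ {suc n} f g =
  trans (cong (f zero + g zero +_) (∑-distrib-+ (f ∘ suc) (g ∘ suc))) (interchange (f zero) (g zero) _ _)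

∑∈-cong : ∀ {n} {P Q : Fin n → Bool} {f g : Fin n → ℕ} →
  (∀ s → P s ≡ Q s) → (∀ s → Q s ≡ true → f s ≡ g s) → ∑∈ P f ≡ ∑∈ Q g
∑∈-cong {P = P} {Q} {f} {g} P≗Q f≗g = ∑-cong pointwise
  where
  pointwise : ∀ s → (if P s then f s else 0) ≡ (if Q s then g s else 0)
  pointwise s rewrite P≗Q s with Q s in Qs
  ... | true  = f≗g s Qs
  ... | false = refl

∣S∣≡count : ∀ {n} (S : Subset n) → ∣ S ∣ ≡ count (lookup S)
∣S∣≡count []          = refl
∣S∣≡count (true ∷ S)  = cong suc (∣S∣≡count S)
∣S∣≡count (false ∷ S) = ∣S∣≡count S

∣tabulate∣≡count : ∀ {n} (P : Fin n → Bool) → ∣ tabulate P ∣ ≡ count P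
∣tabulate∣≡count P = trans (∣S∣≡count (tabulate P)) (∑∈-cong (lookup∘tabulate P) (λ _ _ → refl))

count-all : ∀ n → count {n} (λ _ → true) ≡ n
count-all zero    = refl
count-all (suc n) = cong suc (count-all n)

count-<ᵇ : ∀ n K → K ≤ n → count {n} (λ i → toℕ i <ᵇ K) ≡ K
count-<ᵇ zero    zero    _         = refl
count-<ᵇ (suc n) zero    _         = count-<ᵇ n zero z≤n
count-<ᵇ (suc n) (suc K) (s≤s K≤n) = cong suc (count-<ᵇ n K K≤n)

*-count≤∑∈ : ∀ {n} c (P : Fin n → Bool) (f : Fin n → ℕ) →
  (∀ s → P s ≡ true → c ≤ f s) → c * count P ≤ ∑∈ P f
*-count≤∑∈ {zero}  c P f big = ≤-reflexive (*-zeroʳ c)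
*-count≤∑∈ {suc n} c P f big with P zero in P0
... | true  = ≤-trans (≤-reflexive (*-suc c _))
                (+-mono-≤ (big zero P0) (*-count≤∑∈ c (P ∘ suc) (f ∘ suc) (big ∘ suc)))
... | false = *-count≤∑∈ c (P ∘ suc) (f ∘ suc) (big ∘ suc)

∑∈≤*-count : ∀ {n} c (P : Fin n → Bool) (f : Fin n → ℕ) →
  (∀ s → P s ≡ true → f s ≤ c) → ∑∈ P f ≤ c * count P
∑∈≤*-count {zero}  c P f small = z≤n
∑∈≤*-count {suc n} c P f small with P zero in P0
... | true  = ≤-trans
                (+-mono-≤ (small zero P0) (∑∈≤*-count c (P ∘ suc) (f ∘ suc) (small ∘ suc)))
                (≤-reflexive (sym (*-suc c _)))
... | false = ∑∈≤*-count c (P ∘ suc) (f ∘ suc) (small ∘ suc)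

count≤∑∈ : ∀ {n} (P : Fin n → Bool) (f : Fin n → ℕ) → (∀ s → P s ≡ true → 1 ≤ f s) → count P ≤ ∑∈ P f
count≤∑∈ P f pos = subst (_≤ ∑∈ P f) (*-identityˡ _) (*-count≤∑∈ 1 P f pos)

*-[count∸1]≤∑∈ : ∀ {n} c (P : Fin n → Bool) (f : Fin n → ℕ) →
  (∀ s t → P s ≡ true → P t ≡ true → s ≢ t → c ≤ f s ⊎ c ≤ f t) → c * (count P ∸ 1) ≤ ∑∈ P f
*-[count∸1]≤∑∈ {zero}  c P f big = ≤-reflexive (*-zeroʳ c)
*-[count∸1]≤∑∈ {suc n} c P f big with P zero in P0
... | false = *-[count∸1]≤∑∈ c (P ∘ suc) (f ∘ suc) (λ s t Ps Pt s≢t → big (suc s) (suc t) Ps Pt (s≢t ∘ fsuc-injective))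
... | true with c ≤? f zero
...   | yes c≤f0 = ≤-trans (c*m≤c+c*[m∸1] c (count (P ∘ suc))) (+-mono-≤ c≤f0 (*-[count∸1]≤∑∈ c (P ∘ suc) (f ∘ suc)
                     (λ s t Ps Pt s≢t → big (suc s) (suc t) Ps Pt (s≢t ∘ fsuc-injective))))
  where
  c*m≤c+c*[m∸1] : ∀ c m → c * m ≤ c + c * (m ∸ 1)
  c*m≤c+c*[m∸1] c zero    = ≤-trans (≤-reflexive (*-zeroʳ c)) z≤n
  c*m≤c+c*[m∸1] c (suc m) = ≤-reflexive (*-suc c m)
...   | no c≰f0 = ≤-trans (*-count≤∑∈ c (P ∘ suc) (f ∘ suc) rest-big) (m≤n+m _ _)
  where
  rest-big : ∀ s → P (suc s) ≡ true → c ≤ f (suc s)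
  rest-big s Ps with big zero (suc s) P0 Ps (λ ())
  ... | inj₁ c≤f0 = contradiction c≤f0 c≰f0
  ... | inj₂ c≤fs = c≤fs

*-[count∸2]≤∑∈ : ∀ {n} c (P : Fin n → Bool) (f : Fin n → ℕ) →
  (∀ s t u → P s ≡ true → P t ≡ true → P u ≡ true → s ≢ t → s ≢ u → t ≢ u →
     c ≤ f s ⊎ c ≤ f t ⊎ c ≤ f u) →
  c * (count P ∸ 2) ≤ ∑∈ P f
*-[count∸2]≤∑∈ {zero}  c P f big = ≤-reflexive (*-zeroʳ c)
*-[count∸2]≤∑∈ {suc n} c P f big with P zero in P0
... | false = *-[count∸2]≤∑∈ c (P ∘ suc) (f ∘ suc) λ s t u Ps Pt Pu s≢t s≢u t≢u →
                big (suc s) (suc t) (suc u) Ps Pt Pu (s≢t ∘ fsuc-injective) (s≢u ∘ fsuc-injective) (t≢u ∘ fsuc-injective)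
... | true with c ≤? f zero
...   | yes c≤f0 = ≤-trans (c*[m∸1]≤c+c*[m∸2] c (count (P ∘ suc))) (+-mono-≤ c≤f0 (*-[count∸2]≤∑∈ c (P ∘ suc) (f ∘ suc)
                     λ s t u Ps Pt Pu s≢t s≢u t≢u →
                       big (suc s) (suc t) (suc u) Ps Pt Pu (s≢t ∘ fsuc-injective) (s≢u ∘ fsuc-injective) (t≢u ∘ fsuc-injective)))
  where
  c*[m∸1]≤c+c*[m∸2] : ∀ c m → c * (m ∸ 1) ≤ c + c * (m ∸ 2)
  c*[m∸1]≤c+c*[m∸2] c zero          = ≤-trans (≤-reflexive (*-zeroʳ c)) z≤n
  c*[m∸1]≤c+c*[m∸2] c (suc zero)    = ≤-trans (≤-reflexive (*-zeroʳ c)) z≤n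
  c*[m∸1]≤c+c*[m∸2] c (suc (suc m)) = ≤-reflexive (*-suc c m)
...   | no c≰f0 = ≤-trans (*-[count∸1]≤∑∈ c (P ∘ suc) (f ∘ suc) rest-big) (m≤n+m _ _)
  where
  rest-big : ∀ s t → P (suc s) ≡ true → P (suc t) ≡ true → s ≢ t → c ≤ f (suc s) ⊎ c ≤ f (suc t)
  rest-big s t Ps Pt s≢t with big zero (suc s) (suc t) P0 Ps Pt (λ ()) (λ ()) (s≢t ∘ fsuc-injective)
  ... | inj₁ c≤f0 = contradiction c≤f0 c≰f0
  ... | inj₂ c≤f  = c≤f

─⇒∈ : ∀ {n} (P : Fin n → Bool) a s → (P ─ a) s ≡ true → P s ≡ true
─⇒∈ P zero    (suc s) e = e
─⇒∈ P (suc a) zero    e = e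
─⇒∈ P (suc a) (suc s) e = ─⇒∈ (P ∘ suc) a s e

─⇒≢ : ∀ {n} (P : Fin n → Bool) a s → (P ─ a) s ≡ true → s ≢ a
─⇒≢ P zero    zero    () 
─⇒≢ P zero    (suc s) e  ()
─⇒≢ P (suc a) zero    e  ()
─⇒≢ P (suc a) (suc s) e  = ─⇒≢ (P ∘ suc) a s e ∘ fsuc-injective

∈─ : ∀ {n} (P : Fin n → Bool) a s → P s ≡ true → s ≢ a → (P ─ a) s ≡ true
∈─ P zero    zero    Ps s≢a = contradiction refl s≢a
∈─ P zero    (suc s) Ps s≢a = Ps
∈─ P (suc a) zero    Ps s≢a = Ps
∈─ P (suc a) (suc s) Ps s≢a = ∈─ (P ∘ suc) a s Ps (s≢a ∘ cong suc)

∑∈-remove : ∀ {n} (P : Fin n → Bool) (f : Fin n → ℕ) a → P a ≡ true → ∑∈ P f ≡ f a + ∑∈ (P ─ a) f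
∑∈-remove P f zero    Pa rewrite Pa = refl
∑∈-remove P f (suc a) Pa with P zero
... | true  = trans (cong (f zero +_) (∑∈-remove (P ∘ suc) (f ∘ suc) a Pa)) (x∙yz≈y∙xz (f zero) (f (suc a)) _)
... | false = ∑∈-remove (P ∘ suc) (f ∘ suc) a Pa

count-remove : ∀ {n} (P : Fin n → Bool) a → P a ≡ true → count P ≡ suc (count (P ─ a))
count-remove P = ∑∈-remove P (λ _ → 1)

1≤count : ∀ {n} (P : Fin n → Bool) a → P a ≡ true → 1 ≤ count P
1≤count P a Pa = ≤-trans (s≤s z≤n) (≤-reflexive (sym (count-remove P a Pa)))

f≤∑∈ : ∀ {n} (P : Fin n → Bool) (f : Fin n → ℕ) a → P a ≡ true → f a ≤ ∑∈ P f
f≤∑∈ P f a Pa = ≤-trans (m≤m+n _ _) (≤-reflexive (sym (∑∈-remove P f a Pa)))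

f+f≤∑∈ : ∀ {n} (P : Fin n → Bool) (f : Fin n → ℕ) a b → P a ≡ true → P b ≡ true → a ≢ b → f a + f b ≤ ∑∈ P f
f+f≤∑∈ P f a b Pa Pb a≢b = ≤-trans (+-monoʳ-≤ (f a) (f≤∑∈ (P ─ a) f b (∈─ P a b Pb (a≢b ∘ sym))))
                                    (≤-reflexive (sym (∑∈-remove P f a Pa)))

∑∈-vanishing : ∀ {n} (P : Fin n → Bool) (f : Fin n → ℕ) → (∀ s → P s ≡ true → f s ≡ 0) → ∑∈ P f ≡ 0
∑∈-vanishing {zero}  P f vanish = refl
∑∈-vanishing {suc n} P f vanish with P zero in P0
... | true  = cong₂ _+_ (vanish zero P0) (∑∈-vanishing (P ∘ suc) (f ∘ suc) (vanish ∘ suc))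
... | false = ∑∈-vanishing (P ∘ suc) (f ∘ suc) (vanish ∘ suc)

∑∈-concentrated : ∀ {n} (P : Fin n → Bool) (f : Fin n → ℕ) b →
  (∀ s → s ≢ b → P s ≡ true → f s ≡ 0) → ∑∈ P f ≤ (if P b then f b else 0)
∑∈-concentrated P f b vanish with P b in Pb
... | true  = ≤-reflexive (begin
  ∑∈ P f             ≡⟨ ∑∈-remove P f b Pb ⟩
  f b + ∑∈ (P ─ b) f ≡⟨ cong (f b +_) (∑∈-vanishing (P ─ b) f λ s s∈ →
                          vanish s (─⇒≢ P b s s∈) (─⇒∈ P b s s∈)) ⟩
  f b + 0            ≡⟨ +-identityʳ (f b) ⟩
  f b                ∎)
  where open ≡-Reasoning
... | false = ≤-reflexive (∑∈-vanishing P f λ s Ps → vanish s (λ { refl → contradiction (trans (sym Ps) Pb) λ () }) Ps)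

count≤∑∈-with-surplus : ∀ {n} (P : Fin n → Bool) (f : Fin n → ℕ) a → P a ≡ true → 2 ≤ f a →
  (∀ s t → P s ≡ true → P t ≡ true → s ≢ t → 1 ≤ f s ⊎ 1 ≤ f t) → count P ≤ ∑∈ P f
count≤∑∈-with-surplus P f a Pa 2≤fa one-zero = begin
  count P                            ≡⟨ count-remove P a Pa ⟩
  suc (count (P ─ a))                ≤⟨ 1+m≤2+[m∸1] (count (P ─ a)) ⟩
  2 + (count (P ─ a) ∸ 1)            ≤⟨ +-mono-≤ 2≤fa rest ⟩
  f a + ∑∈ (P ─ a) f                 ≡⟨ ∑∈-remove P f a Pa ⟨
  ∑∈ P f                             ∎
  where
  open ≤-Reasoning
  1+m≤2+[m∸1] : ∀ m → suc m ≤ 2 + (m ∸ 1)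
  1+m≤2+[m∸1] zero    = s≤s z≤n
  1+m≤2+[m∸1] (suc m) = ≤-refl
  rest : count (P ─ a) ∸ 1 ≤ ∑∈ (P ─ a) f
  rest = subst (_≤ ∑∈ (P ─ a) f) (*-identityˡ _) (*-[count∸1]≤∑∈ 1 (P ─ a) f
           λ s t s∈ t∈ → one-zero s t (─⇒∈ P a s s∈) (─⇒∈ P a t t∈))

∑∈≤count∸1 : ∀ {n} (P : Fin n → Bool) (f : Fin n → ℕ) a → P a ≡ true → f a ≡ 0 →
  (∀ s → P s ≡ true → f s ≤ 1) → ∑∈ P f ≤ count P ∸ 1
∑∈≤count∸1 P f a Pa fa≡0 ≤1 rewrite ∑∈-remove P f a Pa | fa≡0 | count-remove P a Pa =
  subst (∑∈ (P ─ a) f ≤_) (*-identityˡ _) (∑∈≤*-count 1 (P ─ a) f λ s s∈ → ≤1 s (─⇒∈ P a s s∈))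

∑∈-positive⇒member : ∀ {n} (P : Fin n → Bool) (f : Fin n → ℕ) → 1 ≤ ∑∈ P f → ∃ λ s → P s ≡ true
∑∈-positive⇒member {suc n} P f pos with P zero in P0
... | true  = zero , P0
... | false = let s , Ps = ∑∈-positive⇒member (P ∘ suc) (f ∘ suc) pos in suc s , Ps

∑-split : ∀ {n} (p : Fin n → Bool) (f : Fin n → ℕ) → ∑ f ≡ ∑∈ p f + ∑∈ (not ∘ p) f
∑-split p f = trans (∑-cong pointwise) (∑-distrib-+ (λ s → if p s then f s else 0) (λ s → if not (p s) then f s else 0))
  where
  pointwise : ∀ s → f s ≡ (if p s then f s else 0) + (if not (p s) then f s else 0)
  pointwise s with p s
  ... | true  = sym (+-identityʳ (f s))
  ... | false = refl

count-compl : ∀ {n} (p : Fin n → Bool) → count p + count (not ∘ p) ≡ n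
count-compl {n} p = trans (sym (∑-split p (λ _ → 1))) (count-all n)

⊆⇒count≤∣∣ : ∀ {n} (P : Fin n → Bool) (S : Subset n) → (∀ s → P s ≡ true → lookup S s ≡ true) → count P ≤ ∣ S ∣
⊆⇒count≤∣∣ P S P⊆S = subst (count P ≤_) (sym (∣S∣≡count S)) (∑-mono-≤ pointwise)
  where
  pointwise : ∀ s → 𝟙 P s ≤ 𝟙 (lookup S) s
  pointwise s with P s in Ps
  ... | true  rewrite P⊆S s Ps = ≤-refl
  ... | false = z≤n

MeetsPairsOf : ∀ {n} → (Fin n → Bool) → Subset n → Set
MeetsPairsOf P S = ∀ x y → P x ≡ true → P y ≡ true → x ≢ y → lookup S x ≡ true ⊎ lookup S y ≡ true

count∸1≤∣∩∣ : ∀ {n} (P : Fin n → Bool) (S : Subset n) → MeetsPairsOf P S → count P ∸ 1 ≤ ∑∈ P (𝟙 (lookup S))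
count∸1≤∣∩∣ P S meets = subst (_≤ ∑∈ P (𝟙 (lookup S))) (*-identityˡ _) (*-[count∸1]≤∑∈ 1 P (𝟙 (lookup S)) one)
  where
  one : ∀ s t → P s ≡ true → P t ≡ true → s ≢ t → 1 ≤ 𝟙 (lookup S) s ⊎ 1 ≤ 𝟙 (lookup S) t
  one s t Ps Pt s≢t with meets s t Ps Pt s≢t
  ... | inj₁ s∈S rewrite s∈S = inj₁ ≤-refl
  ... | inj₂ t∈S rewrite t∈S = inj₂ ≤-refl

meets-all-pairs⇒n∸1≤∣∣ : ∀ {n} (S : Subset n) → MeetsPairsOf (λ _ → true) S → n ∸ 1 ≤ ∣ S ∣
meets-all-pairs⇒n∸1≤∣∣ {n} S meets =
  subst₂ _≤_ (cong (_∸ 1) (count-all n)) (sym (∣S∣≡count S)) (count∸1≤∣∩∣ (λ _ → true) S meets)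

meets-pairs-in-classes⇒n∸2≤∣∣ : ∀ {n} (p : Fin n → Bool) (S : Subset n) →
  MeetsPairsOf p S → MeetsPairsOf (not ∘ p) S → n ∸ 2 ≤ ∣ S ∣
meets-pairs-in-classes⇒n∸2≤∣∣ {n} p S meets meets′ = begin
  n ∸ 2                                              ≤⟨ a+b≡m⇒m∸2≤[a∸1]+[b∸1] {count p} (count-compl p) ⟩
  (count p ∸ 1) + (count (not ∘ p) ∸ 1)              ≤⟨ +-mono-≤ (count∸1≤∣∩∣ p S meets)
                                                                (count∸1≤∣∩∣ (not ∘ p) S meets′) ⟩
  ∑∈ p (𝟙 (lookup S)) + ∑∈ (not ∘ p) (𝟙 (lookup S))  ≡⟨ ∑-split p (𝟙 (lookup S)) ⟨
  count (lookup S)                                   ≡⟨ ∣S∣≡count S ⟨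
  ∣ S ∣                                              ∎
  where
  open ≤-Reasoning
  a+b≡m⇒m∸2≤[a∸1]+[b∸1] : ∀ {a b m} → a + b ≡ m → m ∸ 2 ≤ (a ∸ 1) + (b ∸ 1)
  a+b≡m⇒m∸2≤[a∸1]+[b∸1] {zero}  {b}     refl = ∸-monoʳ-≤ b (s≤s (z≤n {1}))
  a+b≡m⇒m∸2≤[a∸1]+[b∸1] {suc a} {zero}  refl = m∸n≤m (a + 0) 1
  a+b≡m⇒m∸2≤[a∸1]+[b∸1] {suc a} {suc b} refl = ≤-reflexive (cong (_∸ 1) (+-suc a b))

-- Graph distance

≡ᵇ⇒≡′ : ∀ {m n} → (m ≡ᵇ n) ≡ true → m ≡ n
≡ᵇ⇒≡′ {m} {n} e = ≡ᵇ⇒≡ m n (from T-≡ e)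

≡⇒≡ᵇ′ : ∀ {m n} → m ≡ n → (m ≡ᵇ n) ≡ true
≡⇒≡ᵇ′ {m} {n} e = to T-≡ (≡⇒≡ᵇ m n e)

<ᵇ⇒<′ : ∀ {m n} → (m <ᵇ n) ≡ true → m < n
<ᵇ⇒<′ {m} {n} e = <ᵇ⇒< m n (from T-≡ e)

<ᵇ-false : ∀ {m n} → n ≤ m → (m <ᵇ n) ≡ false
<ᵇ-false {m}     {zero}  _         = refl
<ᵇ-false {suc m} {suc n} (s≤s n≤m) = <ᵇ-false n≤m

⌊≟⌋-refl : ∀ {n} (v : Fin n) → ⌊ v ≟ v ⌋ ≡ true
⌊≟⌋-refl v = trans (isYes≗does (v ≟ v)) (dec-true (v ≟ v) refl)

⌊≟⌋-≢ : ∀ {n} {u v : Fin n} → u ≢ v → ⌊ u ≟ v ⌋ ≡ false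
⌊≟⌋-≢ {u = u} {v} u≢v = trans (isYes≗does (u ≟ v)) (dec-false (u ≟ v) u≢v)

reach-suc⁻ : ∀ {n} (G : Graph n) m u v → reach G (suc m) u v ≡ true → ∃ λ w → (G u w ∧ reach G m w v) ≡ true
reach-suc⁻ {n} G m u v e = let w , Tw = satisfied (any⁻ _ (allFin n) (from T-≡ e)) in w , to T-≡ Tw

reach-suc⁺ : ∀ {n} (G : Graph n) m u w v → (G u w ∧ reach G m w v) ≡ true → reach G (suc m) u v ≡ true
reach-suc⁺ G m u w v e = to T-≡ (any⁺ _ (lose (∈-allFin w) (from T-≡ e)))

-- These properties determine D: it is then the graph distance (dist≡D below).
record IsDistance {n} (G : Graph n) (D : Fin n → Fin n → ℕ) : Set where
  field
    D≡0⇒≡   : ∀ u v → D u v ≡ 0 → u ≡ v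
    D-refl  : ∀ u → D u u ≡ 0
    D-edge  : ∀ u w v → G u w ≡ true → D u v ≤ suc (D w v)
    D-step  : ∀ u v d → D u v ≡ suc d → ∃ λ w → G u w ≡ true × D w v ≡ d
    D-bound : ∀ u v → D u v < n

Δ : ∀ {n} → (Fin n → Fin n → ℕ) → Fin n → Fin n → Fin n → ℕ
Δ D x y s = ∣ D x s - D y s ∣

ΔS≡∑∈ : ∀ {n} (G : Graph n) (S : Subset n) x y → ΔS G S x y ≡ ∑∈ (lookup S) (Δ (dist G) x y)
ΔS≡∑∈ G S x y = sum-map-allFin (λ s → if lookup S s then Δ (dist G) x y s else 0)

ΔS-comm : ∀ {n} (G : Graph n) (S : Subset n) x y → ΔS G S x y ≡ ΔS G S y x
ΔS-comm G S x y = begin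
  ΔS G S x y                          ≡⟨ ΔS≡∑∈ G S x y ⟩
  ∑∈ (lookup S) (Δ (dist G) x y)      ≡⟨ ∑∈-cong (λ _ → refl) (λ s _ → ∣-∣-comm (dist G x s) (dist G y s)) ⟩
  ∑∈ (lookup S) (Δ (dist G) y x)      ≡⟨ ΔS≡∑∈ G S y x ⟨
  ΔS G S y x                          ∎
  where open ≡-Reasoning

module _ {n} {G : Graph n} {D : Fin n → Fin n → ℕ} (isD : IsDistance G D) where
  open IsDistance isD

  D≤walk : ∀ m u v → reach G m u v ≡ true → D u v ≤ m
  D≤walk zero    u v e with u ≟ v
  D≤walk zero    u v e | yes refl = ≤-reflexive (D-refl u)
  D≤walk (suc m) u v e with reach-suc⁻ G m u v e
  ... | w , Guw∧walk with G u w in Guw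
  ... | true = ≤-trans (D-edge u w v Guw) (s≤s (D≤walk m w v Guw∧walk))

  walk-of-length-D : ∀ d u v → D u v ≡ d → reach G d u v ≡ true
  walk-of-length-D zero    u v Duv≡0 rewrite D≡0⇒≡ u v Duv≡0 = ⌊≟⌋-refl v
  walk-of-length-D (suc d) u v Duv≡1+d with D-step u v d Duv≡1+d
  ... | w , Guw , Dwv≡d = reach-suc⁺ G d u w v (subst (λ b → (b ∧ reach G d w v) ≡ true) (sym Guw) (walk-of-length-D d w v Dwv≡d))

  distAux≡D : ∀ u v fuel m → m ≤ D u v → D u v < m + fuel → distAux G u v fuel m ≡ D u v
  distAux≡D u v zero       m m≤D D<m = contradiction (subst (D u v <_) (+-identityʳ m) D<m) (≤⇒≯ m≤D)
  distAux≡D u v (suc fuel) m m≤D D<m with reach G m u v in walk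
  ... | true  = ≤-antisym m≤D (D≤walk m u v walk)
  ... | false with m ≟ℕ D u v
  ...   | yes refl = contradiction (trans (sym walk) (walk-of-length-D m u v refl)) λ ()
  ...   | no m≢D   = distAux≡D u v fuel (suc m) (≤∧≢⇒< m≤D m≢D) (subst (D u v <_) (+-suc m fuel) D<m)

  dist≡D : ∀ u v → dist G u v ≡ D u v
  dist≡D u v = distAux≡D u v n 0 z≤n (D-bound u v)

  ΔS≡∑∈Δ : ∀ S x y → ΔS G S x y ≡ ∑∈ (lookup S) (Δ D x y)
  ΔS≡∑∈Δ S x y = trans (ΔS≡∑∈ G S x y) (∑∈-cong (λ _ → refl) λ s _ → cong₂ ∣_-_∣ (dist≡D x s) (dist≡D y s))

  ΔS-tabulate : ∀ P x y → ΔS G (tabulate P) x y ≡ ∑∈ P (Δ D x y)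
  ΔS-tabulate P x y = trans (ΔS≡∑∈Δ (tabulate P) x y) (∑∈-cong (lookup∘tabulate P) (λ _ _ → refl))

  edge⇒Δ≤1 : ∀ x y → G x y ≡ true → G y x ≡ true → ∀ s → Δ D x y s ≤ 1
  edge⇒Δ≤1 x y Gxy Gyx s = ∣a-b∣≤1 (D-edge x y s Gxy) (D-edge y x s Gyx)
    where
    ∣a-b∣≤1 : ∀ {a b} → a ≤ suc b → b ≤ suc a → ∣ a - b ∣ ≤ 1
    ∣a-b∣≤1 {zero}        {zero}        _         _         = z≤n
    ∣a-b∣≤1 {zero}        {suc zero}    _         _         = ≤-refl
    ∣a-b∣≤1 {suc zero}    {zero}        _         _         = ≤-refl
    ∣a-b∣≤1 {suc a}       {suc b}       (s≤s a≤b) (s≤s b≤a) = ∣a-b∣≤1 a≤b b≤a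
    ∣a-b∣≤1 {zero}        {suc (suc b)} _         (s≤s ())
    ∣a-b∣≤1 {suc (suc a)} {zero}        (s≤s ())  _

  edge⇒k≤∣S∣ : ∀ {k x y} (S : Subset n) → G x y ≡ true → G y x ≡ true → x ≢ y → WeakResolving k G S → k ≤ ∣ S ∣
  edge⇒k≤∣S∣ {k} {x} {y} S Gxy Gyx x≢y resolving = begin
    k                            ≤⟨ resolving x y x≢y ⟩
    ΔS G S x y                   ≡⟨ ΔS≡∑∈Δ S x y ⟩
    ∑∈ (lookup S) (Δ D x y)      ≤⟨ ∑∈≤*-count 1 (lookup S) (Δ D x y) (λ s _ → edge⇒Δ≤1 x y Gxy Gyx s) ⟩
    1 * count (lookup S)         ≡⟨ *-identityˡ _ ⟩
    count (lookup S)             ≡⟨ ∣S∣≡count S ⟨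
    ∣ S ∣                        ∎
    where open ≤-Reasoning

  Twins : Fin n → Fin n → Set
  Twins x y = x ≢ y × (∀ s → s ≢ x → s ≢ y → D x s ≡ D y s)

  twins-meet : ∀ {k x y} (S : Subset n) → 1 ≤ k → WeakResolving k G S → Twins x y →
    lookup S x ≡ true ⊎ lookup S y ≡ true
  twins-meet {k} {x} {y} S 1≤k resolving (x≢y , same) with lookup S x in Sx | lookup S y in Sy
  ... | true  | _     = inj₁ refl
  ... | false | true  = inj₂ refl
  ... | false | false = contradiction (begin
    1                        ≤⟨ 1≤k ⟩
    k                        ≤⟨ resolving x y x≢y ⟩
    ΔS G S x y               ≡⟨ ΔS≡∑∈Δ S x y ⟩
    ∑∈ (lookup S) (Δ D x y)  ≡⟨ ∑∈-vanishing (lookup S) (Δ D x y) vanish ⟩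
    0                        ∎) λ ()
    where
    open ≤-Reasoning
    vanish : ∀ s → lookup S s ≡ true → Δ D x y s ≡ 0
    vanish s Ss = m≡n⇒∣m-n∣≡0 (same s (λ { refl → contradiction (trans (sym Ss) Sx) λ () })
                                      (λ { refl → contradiction (trans (sym Ss) Sy) λ () }))

  twin-member : ∀ {k x y} (S : Subset n) → WeakResolving k G S → Twins x y → Δ D x y y < k →
    lookup S x ≡ true
  twin-member {k} {x} {y} S resolving (x≢y , same) Δy<k with lookup S x in Sx
  ... | true  = refl
  ... | false = contradiction (begin
    k                                          ≤⟨ resolving x y x≢y ⟩
    ΔS G S x y                                 ≡⟨ ΔS≡∑∈Δ S x y ⟩
    ∑∈ (lookup S) (Δ D x y)                    ≤⟨ ∑∈-concentrated (lookup S) (Δ D x y) y vanish ⟩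
    (if lookup S y then Δ D x y y else 0)      ≤⟨ if≤ (lookup S y) ⟩
    Δ D x y y                                  ∎) (<⇒≱ Δy<k)
    where
    open ≤-Reasoning
    vanish : ∀ s → s ≢ y → lookup S s ≡ true → Δ D x y s ≡ 0
    vanish s s≢y Ss = m≡n⇒∣m-n∣≡0 (same s (λ { refl → contradiction (trans (sym Ss) Sx) λ () }) s≢y)
    if≤ : ∀ b → (if b then Δ D x y y else 0) ≤ Δ D x y y
    if≤ true  = ≤-refl
    if≤ false = z≤n

module CompleteGraph (m : ℕ) where

  private
    n : ℕ
    n = suc (suc m)

  D : Fin n → Fin n → ℕ
  D u v = if ⌊ u ≟ v ⌋ then 0 else 1

  D-refl : ∀ v → D v v ≡ 0
  D-refl v rewrite ⌊≟⌋-refl v = refl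

  D-≢ : ∀ {u v} → u ≢ v → D u v ≡ 1
  D-≢ u≢v rewrite ⌊≟⌋-≢ u≢v = refl

  D≤1 : ∀ u v → D u v ≤ 1
  D≤1 u v with ⌊ u ≟ v ⌋
  ... | true  = z≤n
  ... | false = ≤-refl

  isDistance : IsDistance (complete n) D
  isDistance = record
    { D≡0⇒≡   = D≡0⇒≡
    ; D-refl  = D-refl
    ; D-edge  = λ u w v _ → ≤-trans (D≤1 u v) (s≤s z≤n)
    ; D-step  = D-step
    ; D-bound = λ u v → s≤s (≤-trans (D≤1 u v) (s≤s z≤n))
    }
    where
    D≡0⇒≡ : ∀ u v → D u v ≡ 0 → u ≡ v
    D≡0⇒≡ u v e with u ≟ v
    ... | yes u≡v = u≡v
    D-step : ∀ u v d → D u v ≡ suc d → ∃ λ w → complete n u w ≡ true × D w v ≡ d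
    D-step u v zero e with u ≟ v
    ... | no u≢v = v , cong not (⌊≟⌋-≢ u≢v) , D-refl v
    D-step u v (suc d) e = contradiction (≤-trans (≤-reflexive (sym e)) (D≤1 u v)) λ { (s≤s ()) }

  twins : ∀ {x y} → x ≢ y → Twins isDistance x y
  twins x≢y = x≢y , λ s s≢x s≢y → trans (D-≢ (s≢x ∘ sym)) (sym (D-≢ (s≢y ∘ sym)))

  Δ-at-y : ∀ {x y} → x ≢ y → Δ D x y y ≡ 1
  Δ-at-y {y = y} x≢y rewrite D-≢ x≢y | D-refl y = refl

  Δ-at-x : ∀ {x y} → x ≢ y → Δ D x y x ≡ 1
  Δ-at-x {x} x≢y rewrite D-refl x | D-≢ (x≢y ∘ sym) = refl

  wdim₁ : IsWDim 1 (complete n) (n ∸ 1)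
  wdim₁ = (tabulate R , resolving , |R|) , minimal
    where
    R : Fin n → Bool
    R = (λ _ → true) ─ zero
    |R| : ∣ tabulate R ∣ ≡ n ∸ 1
    |R| = trans (∣tabulate∣≡count R) (suc-injective (trans (sym (count-remove {n} (λ _ → true) zero refl)) (count-all n)))
    resolving : WeakResolving 1 (complete n) (tabulate R)
    resolving x y x≢y = subst (1 ≤_) (sym (ΔS-tabulate isDistance R x y)) (bound x≢y (x ≟ zero))
      where
      bound : x ≢ y → Dec (x ≡ zero) → 1 ≤ ∑∈ R (Δ D x y)
      bound x≢y (no x≢0)   = subst (_≤ ∑∈ R (Δ D x y)) (Δ-at-x x≢y) (f≤∑∈ R (Δ D x y) x (∈─ _ zero x refl x≢0))
      bound x≢y (yes refl) = subst (_≤ ∑∈ R (Δ D x y)) (Δ-at-y x≢y) (f≤∑∈ R (Δ D x y) y (∈─ _ zero y refl (x≢y ∘ sym)))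
    minimal : ∀ S → WeakResolving 1 (complete n) S → n ∸ 1 ≤ ∣ S ∣
    minimal S resolving = meets-all-pairs⇒n∸1≤∣∣ S λ x y _ _ x≢y → twins-meet isDistance S ≤-refl resolving (twins x≢y)

  wdim₂ : IsWDim 2 (complete n) n
  wdim₂ = (tabulate all , resolving , trans (∣tabulate∣≡count all) (count-all n)) , minimal
    where
    all : Fin n → Bool
    all _ = true
    resolving : WeakResolving 2 (complete n) (tabulate all)
    resolving x y x≢y = begin
      2                         ≡⟨ cong₂ _+_ (Δ-at-x x≢y) (Δ-at-y x≢y) ⟨
      Δ D x y x + Δ D x y y     ≤⟨ f+f≤∑∈ all (Δ D x y) x y refl refl x≢y ⟩
      ∑∈ all (Δ D x y)          ≡⟨ ΔS-tabulate isDistance all x y ⟨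
      ΔS (complete n) (tabulate all) x y ∎
      where open ≤-Reasoning
    other : Fin n → Fin n
    other zero    = suc zero
    other (suc _) = zero
    other≢ : ∀ x → x ≢ other x
    other≢ zero    ()
    other≢ (suc x) ()
    minimal : ∀ S → WeakResolving 2 (complete n) S → n ≤ ∣ S ∣
    minimal S resolving = subst (_≤ ∣ S ∣) (count-all n) (⊆⇒count≤∣∣ all S λ x _ →
      twin-member isDistance S resolving (twins (other≢ x)) (≤-reflexive (cong suc (Δ-at-y (other≢ x)))))

-- Both star n and completeBipartite q r are definitionally of the form G below.
module Bipartition {n} (p : Fin n → Bool) (a b : Fin n) (pa : p a ≡ true) (pb : p b ≡ false) (4≤n : 4 ≤ n) where

  G : Graph n
  G i j = p i xor p j

  offDiagonal : Bool → ℕ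
  offDiagonal true  = 1
  offDiagonal false = 2

  D : Fin n → Fin n → ℕ
  D u v = if ⌊ u ≟ v ⌋ then 0 else offDiagonal (p u xor p v)

  D-refl : ∀ v → D v v ≡ 0
  D-refl v rewrite ⌊≟⌋-refl v = refl

  D-≢ : ∀ {u v} → u ≢ v → D u v ≡ offDiagonal (p u xor p v)
  D-≢ u≢v rewrite ⌊≟⌋-≢ u≢v = refl

  D≤2 : ∀ u v → D u v ≤ 2
  D≤2 u v with ⌊ u ≟ v ⌋ | p u xor p v
  ... | true  | _     = z≤n
  ... | false | true  = s≤s z≤n
  ... | false | false = ≤-refl

  ≡⇒xor≡false : ∀ {c d} → c ≡ d → (c xor d) ≡ false
  ≡⇒xor≡false {true}  refl = refl
  ≡⇒xor≡false {false} refl = refl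

  ≢⇒xor≡true : ∀ {c d} → c ≢ d → (c xor d) ≡ true
  ≢⇒xor≡true {true}  {true}  c≢d = contradiction refl c≢d
  ≢⇒xor≡true {true}  {false} _   = refl
  ≢⇒xor≡true {false} {true}  _   = refl
  ≢⇒xor≡true {false} {false} c≢d = contradiction refl c≢d

  xor≡false⇒≡ : ∀ {c d} → (c xor d) ≡ false → c ≡ d
  xor≡false⇒≡ {true}  {true}  _ = refl
  xor≡false⇒≡ {false} {false} _ = refl

  xor≡true⇒≢ : ∀ {c d} → (c xor d) ≡ true → c ≢ d
  xor≡true⇒≢ {true}  {true}  () refl
  xor≡true⇒≢ {false} {false} () refl

  opposite : Fin n → Fin n
  opposite u = if p u then b else a

  opposite-side : ∀ u → p (opposite u) ≢ p u
  opposite-side u with p u in pu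
  ... | true  = λ e → contradiction (trans (sym pb) e) λ ()
  ... | false = λ e → contradiction (trans (sym pa) e) λ ()

  isDistance : IsDistance G D
  isDistance = record
    { D≡0⇒≡   = D≡0⇒≡
    ; D-refl  = D-refl
    ; D-edge  = D-edge
    ; D-step  = D-step
    ; D-bound = λ u v → ≤-trans (s≤s (D≤2 u v)) (≤-trans (n≤1+n 3) 4≤n)
    }
    where
    D≡0⇒≡ : ∀ u v → D u v ≡ 0 → u ≡ v
    D≡0⇒≡ u v e with u ≟ v | p u xor p v
    ... | yes u≡v | _ = u≡v
    D≡0⇒≡ u v () | no _ | true
    D≡0⇒≡ u v () | no _ | false
    D-edge : ∀ u w v → G u w ≡ true → D u v ≤ suc (D w v)
    D-edge u w v Guw with w ≟ v
    ... | no w≢v = ≤-trans (D≤2 u v) (s≤s (offDiagonal≥1 (p w xor p v)))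
      where
      offDiagonal≥1 : ∀ c → 1 ≤ offDiagonal c
      offDiagonal≥1 true  = ≤-refl
      offDiagonal≥1 false = s≤s z≤n
    ... | yes refl = ≤-reflexive (trans (D-≢ (xor≡true⇒≢ Guw ∘ cong p)) (cong offDiagonal Guw))
    D-step : ∀ u v d → D u v ≡ suc d → ∃ λ w → G u w ≡ true × D w v ≡ d
    D-step u v d e with u ≟ v | p u xor p v in puv
    D-step u v zero       e | no u≢v | true  = v , puv , D-refl v
    D-step u v (suc zero) e | no u≢v | false =
      opposite u , ≢⇒xor≡true (opposite-side u ∘ sym) ,
      trans (D-≢ λ w≡v → opposite-side u (trans (cong p w≡v) pv≡pu))
            (cong offDiagonal (≢⇒xor≡true λ e → opposite-side u (trans e pv≡pu)))
      where
      pv≡pu : p v ≡ p u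
      pv≡pu = sym (xor≡false⇒≡ puv)
    D-step u v d             () | yes _ | _
    D-step u v (suc d)       () | no _  | true
    D-step u v zero          () | no _  | false
    D-step u v (suc (suc d)) () | no _  | false

  twins : ∀ {x y} → x ≢ y → p x ≡ p y → Twins isDistance x y
  twins {x} {y} x≢y px≡py = x≢y , λ s s≢x s≢y → begin
    D x s                  ≡⟨ D-≢ (s≢x ∘ sym) ⟩
    offDiagonal (p x xor p s)    ≡⟨ cong (λ c → offDiagonal (c xor p s)) px≡py ⟩
    offDiagonal (p y xor p s)    ≡⟨ D-≢ (s≢y ∘ sym) ⟨
    D y s                  ∎
    where open ≡-Reasoning

  Δ-twin-x : ∀ {x y} → x ≢ y → p x ≡ p y → Δ D x y x ≡ 2
  Δ-twin-x {x} {y} x≢y px≡py rewrite D-refl x | D-≢ (x≢y ∘ sym) | ≡⇒xor≡false (sym px≡py) = refl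

  Δ-twin-y : ∀ {x y} → x ≢ y → p x ≡ p y → Δ D x y y ≡ 2
  Δ-twin-y {x} {y} x≢y px≡py rewrite D-refl y | D-≢ x≢y | ≡⇒xor≡false px≡py = refl

  Δ-across : ∀ {x y} → p x ≢ p y → ∀ s → Δ D x y s ≡ 1
  Δ-across {x} {y} px≢py s with s ≟ x | s ≟ y
  ... | yes refl | yes refl = contradiction refl px≢py
  ... | yes refl | no s≢y   rewrite D-refl s | D-≢ (s≢y ∘ sym) | ≢⇒xor≡true (px≢py ∘ sym) = refl
  ... | no s≢x   | yes refl rewrite D-refl s | D-≢ (s≢x ∘ sym) | ≢⇒xor≡true px≢py = refl
  ... | no s≢x   | no s≢y   rewrite D-≢ (s≢x ∘ sym) | D-≢ (s≢y ∘ sym) = gap (p x) (p y) (p s) px≢py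
    where
    gap : ∀ c d e → c ≢ d → ∣ offDiagonal (c xor e) - offDiagonal (d xor e) ∣ ≡ 1
    gap true  true  _     c≢d = contradiction refl c≢d
    gap false false _     c≢d = contradiction refl c≢d
    gap true  false true  _   = refl
    gap true  false false _   = refl
    gap false true  true  _   = refl
    gap false true  false _   = refl

  wdim-k≤2 : ∀ k → 1 ≤ k → k ≤ 2 → IsWDim k G (n ∸ 2)
  wdim-k≤2 k 1≤k k≤2 = (tabulate R , resolving , |R|) , minimal
    where
    R : Fin n → Bool
    R = ((λ _ → true) ─ a) ─ b
    b∈ : ((λ _ → true) ─ a) b ≡ true
    b∈ = ∈─ (λ _ → true) a b refl λ { refl → contradiction (trans (sym pa) pb) λ () }
    |R| : ∣ tabulate R ∣ ≡ n ∸ 2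
    |R| = trans (∣tabulate∣≡count R) (cong (_∸ 2) (begin
      suc (suc (count R))                    ≡⟨ cong suc (count-remove _ b b∈) ⟨
      suc (count ((λ _ → true) ─ a))         ≡⟨ count-remove (λ _ → true) a refl ⟨
      count {n} (λ _ → true)                 ≡⟨ count-all n ⟩
      n                                      ∎))
      where open ≡-Reasoning
    2≤|R| : 2 ≤ count R
    2≤|R| = ≤-trans (∸-monoˡ-≤ 2 4≤n) (≤-reflexive (trans (sym |R|) (∣tabulate∣≡count R)))
    outside : ∀ {x y} → x ≢ y → p x ≡ p y → (x ≢ a × x ≢ b) ⊎ (y ≢ a × y ≢ b)
    outside {x} {y} x≢y px≡py with x ≟ a | x ≟ b
    ... | no x≢a   | no x≢b   = inj₁ (x≢a , x≢b)
    ... | yes refl | _        = inj₂ (x≢y ∘ sym , λ { refl → contradiction (trans (sym pa) (trans px≡py pb)) λ () })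
    ... | no _     | yes refl = inj₂ ((λ { refl → contradiction (trans (sym pa) (trans (sym px≡py) pb)) λ () }) , x≢y ∘ sym)
    bound : ∀ {x y} → x ≢ y → Dec (p x ≡ p y) → k ≤ ∑∈ R (Δ D x y)
    bound {x} {y} x≢y (no px≢py) =
      ≤-trans k≤2 (≤-trans 2≤|R| (count≤∑∈ R (Δ D x y) λ s _ → ≤-reflexive (sym (Δ-across px≢py s))))
    bound {x} {y} x≢y (yes px≡py) with outside x≢y px≡py
    ... | inj₁ (x≢a , x≢b) = ≤-trans k≤2 (subst (_≤ ∑∈ R (Δ D x y)) (Δ-twin-x x≢y px≡py)
                               (f≤∑∈ R (Δ D x y) x (∈─ _ b x (∈─ _ a x refl x≢a) x≢b)))
    ... | inj₂ (y≢a , y≢b) = ≤-trans k≤2 (subst (_≤ ∑∈ R (Δ D x y)) (Δ-twin-y x≢y px≡py)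
                               (f≤∑∈ R (Δ D x y) y (∈─ _ b y (∈─ _ a y refl y≢a) y≢b)))
    resolving : WeakResolving k G (tabulate R)
    resolving x y x≢y = subst (k ≤_) (sym (ΔS-tabulate isDistance R x y)) (bound x≢y (p x ≟ᵇ p y))
    minimal : ∀ S → WeakResolving k G S → n ∸ 2 ≤ ∣ S ∣
    minimal S resolving = meets-pairs-in-classes⇒n∸2≤∣∣ p S
      (λ x y px py x≢y → twins-meet isDistance S 1≤k resolving (twins x≢y (trans px (sym py))))
      (λ x y px py x≢y → twins-meet isDistance S 1≤k resolving (twins x≢y (not-injective (trans px (sym py)))))

  wdim-3≤k : (P : Fin n → Bool) → 4 ≤ count P →
    (∀ x y → x ≢ y → p x ≡ p y → P x ≡ true) →
    (∀ x → P x ≡ true → ∃ λ y → y ≢ x × p y ≡ p x) →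
    ∀ k → 3 ≤ k → k ≤ 4 → IsWDim k G (count P)
  wdim-3≤k P 4≤|P| twins⊆P P⊆twins k 3≤k k≤4 = (tabulate P , resolving , ∣tabulate∣≡count P) , minimal
    where
    bound : ∀ {x y} → x ≢ y → Dec (p x ≡ p y) → k ≤ ∑∈ P (Δ D x y)
    bound {x} {y} x≢y (no px≢py) =
      ≤-trans k≤4 (≤-trans 4≤|P| (count≤∑∈ P (Δ D x y) λ s _ → ≤-reflexive (sym (Δ-across px≢py s))))
    bound {x} {y} x≢y (yes px≡py) =
      ≤-trans k≤4 (subst (_≤ ∑∈ P (Δ D x y)) (cong₂ _+_ (Δ-twin-x x≢y px≡py) (Δ-twin-y x≢y px≡py))
        (f+f≤∑∈ P (Δ D x y) x y (twins⊆P x y x≢y px≡py) (twins⊆P y x (x≢y ∘ sym) (sym px≡py)) x≢y))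
    resolving : WeakResolving k G (tabulate P)
    resolving x y x≢y = subst (k ≤_) (sym (ΔS-tabulate isDistance P x y)) (bound x≢y (p x ≟ᵇ p y))
    minimal : ∀ S → WeakResolving k G S → count P ≤ ∣ S ∣
    minimal S resolving = ⊆⇒count≤∣∣ P S λ x Px →
      let y , y≢x , py≡px = P⊆twins x Px
      in twin-member isDistance S resolving (twins (y≢x ∘ sym) (sym py≡px))
           (≤-trans (≤-reflexive (cong suc (Δ-twin-y (y≢x ∘ sym) (sym py≡px)))) 3≤k)

  partner : ∀ {c₁ c₂} → c₁ ≢ c₂ → p c₁ ≡ p c₂ → ∀ x → p x ≡ p c₁ → ∃ λ y → y ≢ x × p y ≡ p x
  partner {c₁} {c₂} c₁≢c₂ pc₁≡pc₂ x px≡pc₁ with x ≟ c₁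
  ... | yes refl = c₂ , c₁≢c₂ ∘ sym , sym pc₁≡pc₂
  ... | no x≢c₁  = c₁ , x≢c₁ ∘ sym , sym px≡pc₁

star-wdim : ∀ n → 5 ≤ n →
  (∀ k → 1 ≤ k → k ≤ 2 → IsWDim k (star n) (n ∸ 2)) × (∀ k → 3 ≤ k → k ≤ 4 → IsWDim k (star n) (n ∸ 1))
star-wdim (suc zero) (s≤s ())
star-wdim (suc (suc zero)) (s≤s (s≤s ()))
star-wdim n@(suc (suc (suc j))) 5≤n = wdim-k≤2 , λ k 3≤k k≤4 →
  subst (IsWDim k (star n)) |leaves| (wdim-3≤k leaf? 4≤|leaves| twins⊆leaves leaves⊆twins k 3≤k k≤4)
  where
  centre? : Fin n → Bool
  centre? i = toℕ i ≡ᵇ 0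
  open Bipartition centre? zero (suc zero) refl refl (≤-trans (n≤1+n 4) 5≤n)
  leaf? : Fin n → Bool
  leaf? = not ∘ centre?
  |leaves| : count leaf? ≡ n ∸ 1
  |leaves| = +-cancelˡ-≡ 1 _ _ (trans (cong (_+ count leaf?) (sym (count-<ᵇ n 1 (s≤s z≤n)))) (count-compl centre?))
  4≤|leaves| : 4 ≤ count leaf?
  4≤|leaves| = subst (4 ≤_) (sym |leaves|) (≤-pred 5≤n)
  twins⊆leaves : ∀ x y → x ≢ y → centre? x ≡ centre? y → leaf? x ≡ true
  twins⊆leaves x y x≢y same with centre? x in cx
  ... | false = refl
  ... | true  = contradiction (toℕ-injective (trans (≡ᵇ⇒≡′ cx) (sym (≡ᵇ⇒≡′ (sym same))))) x≢y
  leaves⊆twins : ∀ x → leaf? x ≡ true → ∃ λ y → y ≢ x × centre? y ≡ centre? x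
  leaves⊆twins x leaf = partner {suc zero} {suc (suc zero)} (λ ()) refl x (not-true leaf)
    where
    not-true : ∀ {b} → not b ≡ true → b ≡ false
    not-true {false} _ = refl

completeBipartite-wdim : ∀ q r → 2 ≤ q → 2 ≤ r →
  (∀ k → 1 ≤ k → k ≤ 2 → IsWDim k (completeBipartite q r) (q + r ∸ 2)) ×
  (∀ k → 3 ≤ k → k ≤ 4 → IsWDim k (completeBipartite q r) (q + r))
completeBipartite-wdim (suc zero) r (s≤s ()) 2≤r
completeBipartite-wdim q@(suc (suc q′)) r 2≤q 2≤r = wdim-k≤2 , λ k 3≤k k≤4 →
  subst (IsWDim k (completeBipartite q r)) (count-all (q + r))
    (wdim-3≤k (λ _ → true) (subst (4 ≤_) (sym (count-all (q + r))) 4≤q+r) (λ _ _ _ _ → refl) everyone-has-twin k 3≤k k≤4)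
  where
  left? : Fin (q + r) → Bool
  left? i = toℕ i <ᵇ q
  4≤q+r : 4 ≤ q + r
  4≤q+r = +-mono-≤ 2≤q 2≤r
  q<q+r : q < q + r
  q<q+r = m<m+n q (≤-trans (s≤s z≤n) 2≤r)
  1+q<q+r : suc q < q + r
  1+q<q+r = subst (_≤ q + r) (+-comm q 2) (+-monoʳ-≤ q 2≤r)
  right₁ right₂ : Fin (q + r)
  right₁ = fromℕ< q<q+r
  right₂ = fromℕ< 1+q<q+r
  right₁-right : left? right₁ ≡ false
  right₁-right = trans (cong (_<ᵇ q) (toℕ-fromℕ< q<q+r)) (<ᵇ-false {q} ≤-refl)
  right₂-right : left? right₂ ≡ false
  right₂-right = trans (cong (_<ᵇ q) (toℕ-fromℕ< 1+q<q+r)) (<ᵇ-false (n≤1+n q))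
  open Bipartition left? zero right₁ refl right₁-right 4≤q+r
  right₁≢right₂ : right₁ ≢ right₂
  right₁≢right₂ e = <-irrefl (trans (sym (toℕ-fromℕ< q<q+r)) (trans (cong toℕ e) (toℕ-fromℕ< 1+q<q+r))) (n<1+n q)
  everyone-has-twin : ∀ x → true ≡ true → ∃ λ y → y ≢ x × left? y ≡ left? x
  everyone-has-twin x _ = on-side (left? x) refl
    where
    on-side : ∀ b → left? x ≡ b → ∃ λ y → y ≢ x × left? y ≡ left? x
    on-side true  side = partner {zero} {suc zero} (λ ()) refl x side
    on-side false side = partner right₁≢right₂ (trans right₁-right (sym right₂-right)) x (trans side (sym right₁-right))

-- Arithmetic and parity on ℕ

∣m-n∣+m≡n : ∀ {m n} → m ≤ n → ∣ m - n ∣ + m ≡ n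
∣m-n∣+m≡n m≤n = trans (cong (_+ _) (m≤n⇒∣m-n∣≡n∸m m≤n)) (m∸n+n≡m m≤n)

∣m-n∣+n≡m : ∀ {m n} → n ≤ m → ∣ m - n ∣ + n ≡ m
∣m-n∣+n≡m n≤m = trans (cong (_+ _) (m≤n⇒∣n-m∣≡n∸m n≤m)) (m∸n+n≡m n≤m)

∣1+m-m∣≡1 : ∀ m → ∣ suc m - m ∣ ≡ 1
∣1+m-m∣≡1 zero    = refl
∣1+m-m∣≡1 (suc m) = ∣1+m-m∣≡1 m

∣m-1+m∣≡1 : ∀ m → ∣ m - suc m ∣ ≡ 1
∣m-1+m∣≡1 m = trans (∣-∣-comm m (suc m)) (∣1+m-m∣≡1 m)

∣-∣-step : ∀ a b d → ∣ a - b ∣ ≡ suc d → ∃ λ c → c ≤ a ⊔ b × ∣ a - c ∣ ≡ 1 × ∣ c - b ∣ ≡ d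
∣-∣-step zero    (suc b) d e = 1 , s≤s z≤n , refl , suc-injective e
∣-∣-step (suc a) zero    d e = a , n≤1+n a , ∣1+m-m∣≡1 a , trans (∣-∣-identityʳ a) (suc-injective e)
∣-∣-step (suc a) (suc b) d e = let c , c≤ , e₁ , e₂ = ∣-∣-step a b d e in suc c , s≤s c≤ , e₁ , e₂

∣-∣-equidistant : ∀ a b s → ∣ a - s ∣ ≡ ∣ b - s ∣ → a ≡ b ⊎ a + b ≡ s + s
∣-∣-equidistant a b s e with ≤-total a s | ≤-total b s
... | inj₁ a≤s | inj₁ b≤s =
  inj₁ (+-cancelˡ-≡ ∣ a - s ∣ a b (trans (∣m-n∣+m≡n a≤s) (sym (trans (cong (_+ b) e) (∣m-n∣+m≡n b≤s)))))
... | inj₂ s≤a | inj₂ s≤b = inj₁ (trans (sym (∣m-n∣+n≡m s≤a)) (trans (cong (_+ s) e) (∣m-n∣+n≡m s≤b)))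
... | inj₁ a≤s | inj₂ s≤b = inj₂ (begin
  a + b                   ≡⟨ cong (a +_) (∣m-n∣+n≡m s≤b) ⟨
  a + (∣ b - s ∣ + s)     ≡⟨ cong (λ z → a + (z + s)) e ⟨
  a + (∣ a - s ∣ + s)     ≡⟨ +-assoc a _ s ⟨
  a + ∣ a - s ∣ + s       ≡⟨ cong (_+ s) (+-comm a _) ⟩
  ∣ a - s ∣ + a + s       ≡⟨ cong (_+ s) (∣m-n∣+m≡n a≤s) ⟩
  s + s                   ∎)
  where open ≡-Reasoning
... | inj₂ s≤a | inj₁ b≤s = inj₂ (begin
  a + b                   ≡⟨ cong (_+ b) (∣m-n∣+n≡m s≤a) ⟨
  ∣ a - s ∣ + s + b       ≡⟨ +-assoc _ s b ⟩
  ∣ a - s ∣ + (s + b)     ≡⟨ cong (∣ a - s ∣ +_) (+-comm s b) ⟩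
  ∣ a - s ∣ + (b + s)     ≡⟨ +-assoc _ b s ⟨
  ∣ a - s ∣ + b + s       ≡⟨ cong (λ z → z + b + s) e ⟩
  ∣ b - s ∣ + b + s       ≡⟨ cong (_+ s) (∣m-n∣+m≡n b≤s) ⟩
  s + s                   ∎)
  where open ≡-Reasoning

m+m-injective : ∀ {m n} → m + m ≡ n + n → m ≡ n
m+m-injective {zero}  {zero}  e = refl
m+m-injective {suc m} {suc n} e =
  cong suc (m+m-injective (suc-injective (trans (sym (+-suc m m)) (trans (suc-injective e) (+-suc n n)))))

parity-suc : ∀ m → parity (suc m) ≡ parity m ⁻¹
parity-suc m = trans (sym (ℙ.⁻¹-involutive (parity (suc m)))) (cong _⁻¹ (ℙ.suc-homo-⁻¹ m))

parity-double : ∀ m → parity (m + m) ≡ 0ℙ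
parity-double m = trans (ℙ.+-homo-+ m m) (ℙ.p+p≡0ℙ (parity m))

parity-∣-∣ : ∀ m n → parity ∣ m - n ∣ ≡ parity m +ℙ parity n
parity-∣-∣ zero    n       = refl
parity-∣-∣ (suc m) zero    = sym (ℙ.+-identityʳ _)
parity-∣-∣ (suc m) (suc n) = begin
  parity ∣ m - n ∣                ≡⟨ parity-∣-∣ m n ⟩
  parity m +ℙ parity n            ≡⟨ flip-both (parity m) (parity n) ⟩
  parity m ⁻¹ +ℙ parity n ⁻¹      ≡⟨ cong₂ _+ℙ_ (parity-suc m) (parity-suc n) ⟨
  parity (suc m) +ℙ parity (suc n) ∎
  where
  open ≡-Reasoning
  flip-both : ∀ p q → p +ℙ q ≡ p ⁻¹ +ℙ q ⁻¹
  flip-both 0ℙ 0ℙ = refl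
  flip-both 0ℙ 1ℙ = refl
  flip-both 1ℙ 0ℙ = refl
  flip-both 1ℙ 1ℙ = refl

parity-shift : ∀ {p} q r → p ≡ q +ℙ r → r ≡ p +ℙ q
parity-shift 0ℙ 0ℙ refl = refl
parity-shift 0ℙ 1ℙ refl = refl
parity-shift 1ℙ 0ℙ refl = refl
parity-shift 1ℙ 1ℙ refl = refl

odd≢double : ∀ m n → suc (m + m) ≢ n + n
odd≢double m n e = contradiction (trans (sym (parity-suc (m + m))) (trans (cong parity e) (parity-double n)))
                     (subst (λ p → p ⁻¹ ≢ 0ℙ) (sym (parity-double m)) λ ())

2∣⇒parity≡0ℙ : ∀ {n} → 2 ∣ n → parity n ≡ 0ℙ
2∣⇒parity≡0ℙ (divides q refl) = trans (ℙ.*-homo-* q 2) (ℙ.*-zeroʳ (parity q))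

parity≡0ℙ⇒2∣ : ∀ n → parity n ≡ 0ℙ → 2 ∣ n
parity≡0ℙ⇒2∣ zero          _ = divides 0 refl
parity≡0ℙ⇒2∣ (suc (suc n)) e = ∣m∣n⇒∣m+n (∣-refl {2}) (parity≡0ℙ⇒2∣ n e)

odd⇒pred-double : ∀ m → ¬ 2 ∣ suc m → ∃ λ h → m ≡ h + h
odd⇒pred-double m odd with parity m in e
... | 0ℙ with parity≡0ℙ⇒2∣ m e
...   | divides h m≡h*2 = h , trans m≡h*2 (trans (*-comm h 2) (cong (h +_) (+-identityʳ h)))
odd⇒pred-double m odd | 1ℙ = contradiction (parity≡0ℙ⇒2∣ (suc m) (trans (parity-suc m) (cong _⁻¹ e))) odd

module Path (n : ℕ) (2≤n : 2 ≤ n) where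

  D : Fin n → Fin n → ℕ
  D u v = ∣ toℕ u - toℕ v ∣

  isDistance : IsDistance (path n) D
  isDistance = record
    { D≡0⇒≡   = λ u v → toℕ-injective ∘ ∣m-n∣≡0⇒m≡n
    ; D-refl  = λ u → ∣n-n∣≡0 (toℕ u)
    ; D-edge  = λ u w v e → subst (λ z → D u v ≤ z + D w v) (≡ᵇ⇒≡′ e) (∣-∣-triangle (toℕ u) (toℕ w) (toℕ v))
    ; D-step  = D-step
    ; D-bound = λ u v → ≤-<-trans (∣m-n∣≤m⊔n (toℕ u) (toℕ v)) (⊔-lub (toℕ<n u) (toℕ<n v))
    }
    where
    D-step : ∀ u v d → D u v ≡ suc d → ∃ λ w → path n u w ≡ true × D w v ≡ d
    D-step u v d e =
      let c , c≤ , e₁ , e₂ = ∣-∣-step (toℕ u) (toℕ v) d e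
          c<n = ≤-<-trans c≤ (⊔-lub (toℕ<n u) (toℕ<n v))
      in fromℕ< c<n , ≡⇒≡ᵇ′ (trans (cong (∣ toℕ u -_∣) (toℕ-fromℕ< c<n)) e₁)
                    , trans (cong (∣_- toℕ v ∣) (toℕ-fromℕ< c<n)) e₂

  Δ≡0⇒midpoint : ∀ x y s → x ≢ y → Δ D x y s ≡ 0 → toℕ x + toℕ y ≡ toℕ s + toℕ s
  Δ≡0⇒midpoint x y s x≢y Δ≡0 with ∣-∣-equidistant (toℕ x) (toℕ y) (toℕ s) (∣m-n∣≡0⇒m≡n Δ≡0)
  ... | inj₁ x≡y = contradiction (toℕ-injective x≡y) x≢y
  ... | inj₂ e   = e

  at-most-one-zero : ∀ x y → x ≢ y → ∀ s t → s ≢ t → 1 ≤ Δ D x y s ⊎ 1 ≤ Δ D x y t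
  at-most-one-zero x y x≢y s t s≢t with Δ D x y s ≟ℕ 0 | Δ D x y t ≟ℕ 0
  ... | no Δs≢0  | _        = inj₁ (n≢0⇒n>0 Δs≢0)
  ... | yes _    | no Δt≢0  = inj₂ (n≢0⇒n>0 Δt≢0)
  ... | yes Δs≡0 | yes Δt≡0 = contradiction
    (toℕ-injective (m+m-injective (trans (sym (Δ≡0⇒midpoint x y s x≢y Δs≡0)) (Δ≡0⇒midpoint x y t x≢y Δt≡0)))) s≢t

  wdim : ∀ k → 1 ≤ k → k ≤ n → IsWDim k (path n) k
  wdim k 1≤k k≤n = (tabulate P , resolving , trans (∣tabulate∣≡count P) |P|) , minimal
    where
    P : Fin n → Bool
    P i = toℕ i <ᵇ k
    |P| : count P ≡ k
    |P| = count-<ᵇ n k k≤n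
    0<n : 0 < n
    0<n = ≤-trans (s≤s z≤n) 2≤n
    v₀ v₁ : Fin n
    v₀ = fromℕ< 0<n
    v₁ = fromℕ< 2≤n
    bound : ∀ x y → toℕ x < toℕ y → k ≤ ∑∈ P (Δ D x y)
    bound x y x<y with toℕ y ≟ℕ suc (toℕ x)
    ... | yes y≡1+x = subst (_≤ ∑∈ P (Δ D x y)) |P| (count≤∑∈ P (Δ D x y) λ s _ → n≢0⇒n>0 λ Δ≡0 →
          odd≢double (toℕ x) (toℕ s) (trans (sym (+-suc (toℕ x) (toℕ x))) (trans (cong (toℕ x +_) (sym y≡1+x))
            (Δ≡0⇒midpoint x y s (λ { refl → <-irrefl refl x<y }) Δ≡0))))
    ... | no y≢1+x = subst (_≤ ∑∈ P (Δ D x y)) |P| (count≤∑∈-with-surplus P (Δ D x y) v₀ v₀∈P 2≤Δ₀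
          λ s t _ _ → at-most-one-zero x y (λ { refl → <-irrefl refl x<y }) s t)
      where
      v₀∈P : P v₀ ≡ true
      v₀∈P rewrite toℕ-fromℕ< 0<n = to T-≡ (<⇒<ᵇ 1≤k)
      2≤Δ₀ : 2 ≤ Δ D x y v₀
      2≤Δ₀ rewrite toℕ-fromℕ< 0<n | ∣-∣-identityʳ (toℕ x) | ∣-∣-identityʳ (toℕ y) =
        subst (2 ≤_) (sym (m≤n⇒∣m-n∣≡n∸m (<⇒≤ x<y))) (gap x<y y≢1+x)
        where
        gap : ∀ {a b} → a < b → b ≢ suc a → 2 ≤ b ∸ a
        gap {zero}  {suc zero}    _         b≢1+a = contradiction refl b≢1+a
        gap {zero}  {suc (suc b)} _         _     = s≤s (s≤s z≤n)
        gap {suc a} {suc b}       (s≤s a<b) b≢1+a = gap a<b (b≢1+a ∘ cong suc)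
    resolving : WeakResolving k (path n) (tabulate P)
    resolving x y x≢y with <-cmp (toℕ x) (toℕ y)
    ... | tri< x<y _ _ = subst (k ≤_) (sym (ΔS-tabulate isDistance P x y)) (bound x y x<y)
    ... | tri≈ _ x≡y _ = contradiction (toℕ-injective x≡y) x≢y
    ... | tri> _ _ y<x = subst (k ≤_) (trans (sym (ΔS-tabulate isDistance P y x)) (ΔS-comm (path n) (tabulate P) y x)) (bound y x y<x)
    minimal : ∀ S → WeakResolving k (path n) S → k ≤ ∣ S ∣
    minimal S = edge⇒k≤∣S∣ isDistance S v₀v₁ v₁v₀ λ v₀≡v₁ →
      0≢1+n (trans (sym (toℕ-fromℕ< 0<n)) (trans (cong toℕ v₀≡v₁) (toℕ-fromℕ< 2≤n)))
      where
      v₀v₁ : path n v₀ v₁ ≡ true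
      v₀v₁ rewrite toℕ-fromℕ< 0<n | toℕ-fromℕ< 2≤n = refl
      v₁v₀ : path n v₁ v₀ ≡ true
      v₁v₀ rewrite toℕ-fromℕ< 0<n | toℕ-fromℕ< 2≤n = refl

module CycleArithmetic (m : ℕ) where

  n : ℕ
  n = suc m

  arc : ℕ → ℕ
  arc e = e ⊓ (n ∸ e)

  cdist : ℕ → ℕ → ℕ
  cdist a b = arc ∣ a - b ∣

  ∣-∣<n : ∀ {a b} → a < n → b < n → ∣ a - b ∣ < n
  ∣-∣<n {a} {b} a<n b<n = ≤-<-trans (∣m-n∣≤m⊔n a b) (⊔-lub a<n b<n)

  cdist-refl : ∀ a → cdist a a ≡ 0
  cdist-refl a rewrite ∣n-n∣≡0 a = refl

  cdist≡0⇒≡ : ∀ {a b} → a < n → b < n → cdist a b ≡ 0 → a ≡ b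
  cdist≡0⇒≡ {a} {b} a<n b<n e with ⊓-sel ∣ a - b ∣ (n ∸ ∣ a - b ∣)
  ... | inj₁ q = ∣m-n∣≡0⇒m≡n (trans (sym q) e)
  ... | inj₂ q = contradiction (m∸n≡0⇒m≤n (trans (sym q) e)) (<⇒≱ (∣-∣<n a<n b<n))

  cdist<n : ∀ {a b} → a < n → b < n → cdist a b < n
  cdist<n a<n b<n = ≤-<-trans (m⊓n≤m _ _) (∣-∣<n a<n b<n)

  arc-step : ∀ e e′ → e ≤ suc e′ → e′ ≤ suc e → arc e ≤ suc (arc e′)
  arc-step e e′ e≤ e′≤ = ⊓-glb (≤-trans (m⊓n≤m e (n ∸ e)) e≤) (begin
    e ⊓ (n ∸ e)        ≤⟨ m⊓n≤n e (n ∸ e) ⟩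
    n ∸ e              ≤⟨ m≤suc[pred[m]] (n ∸ e) ⟩
    suc (pred (n ∸ e)) ≡⟨ cong suc (pred[m∸n]≡m∸[1+n] n e) ⟩
    suc (n ∸ suc e)    ≤⟨ s≤s (∸-monoʳ-≤ n e′≤) ⟩
    suc (n ∸ e′)       ∎)
    where
    open ≤-Reasoning
    m≤suc[pred[m]] : ∀ m → m ≤ suc (pred m)
    m≤suc[pred[m]] zero    = z≤n
    m≤suc[pred[m]] (suc m) = ≤-refl

  arc-complement : ∀ e e′ → e + e′ ≡ m → arc e ≤ suc (arc e′)
  arc-complement e e′ e+e′≡m = ⊓-glb (≤-trans (m⊓n≤n e _) (≤-reflexive n∸e≡1+e′))
    (≤-trans (m⊓n≤m e _) (≤-trans (n≤1+n e) (s≤s (≤-trans (n≤1+n e) (≤-reflexive (sym n∸e′≡1+e))))))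
    where
    n∸e≡1+e′ : n ∸ e ≡ suc e′
    n∸e≡1+e′ = trans (cong (λ z → suc z ∸ e) (sym e+e′≡m)) (trans (cong (_∸ e) (sym (+-suc e e′))) (m+n∸m≡n e (suc e′)))
    n∸e′≡1+e : n ∸ e′ ≡ suc e
    n∸e′≡1+e = trans (cong (λ z → suc z ∸ e′) (sym e+e′≡m)) (m+n∸n≡m (suc e) e′)

  arc-1+e : ∀ {d e} → d + e ≡ m → suc d < e → arc (suc e) ≡ d
  arc-1+e {d} {e} d+e≡m 1+d<e =
    trans (cong (suc e ⊓_) m∸e≡d) (m≥n⇒m⊓n≡n (≤-trans (n≤1+n d) (≤-trans (<⇒≤ 1+d<e) (n≤1+n e))))
    where
    m∸e≡d : m ∸ e ≡ d
    m∸e≡d = trans (cong (_∸ e) (sym d+e≡m)) (m+n∸n≡m d e)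

  arc-d : ∀ {d e} → d + e ≡ m → suc d < e → arc d ≡ d
  arc-d {d} {e} d+e≡m 1+d<e = m≤n⇒m⊓n≡m (begin
    d          ≤⟨ ≤-trans (n≤1+n d) (≤-trans (<⇒≤ 1+d<e) (n≤1+n e)) ⟩
    suc e      ≡⟨ m+n∸m≡n d (suc e) ⟨
    d + suc e ∸ d ≡⟨ cong (_∸ d) (trans (+-suc d e) (cong suc d+e≡m)) ⟩
    n ∸ d      ∎)
    where open ≤-Reasoning

  wraparound-ends : ∀ {a c} → a ≤ c → c ≤ m → ∣ a - c ∣ ≡ m → a ≡ 0 × c ≡ m
  wraparound-ends {a} {c} a≤c c≤m e = a≡0 , trans (sym m+a≡c) (trans (cong (m +_) a≡0) (+-identityʳ m))
    where
    m+a≡c : m + a ≡ c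
    m+a≡c = trans (cong (_+ a) (sym e)) (∣m-n∣+m≡n a≤c)
    a≡0 : a ≡ 0
    a≡0 = n≤0⇒n≡0 (+-cancelˡ-≤ m a 0 (≤-trans (≤-reflexive m+a≡c) (≤-trans c≤m (≤-reflexive (sym (+-identityʳ m))))))

  ∣-∣-wraparound : ∀ {a c v} → a < n → c < n → v < n → ∣ a - c ∣ ≡ m → ∣ a - v ∣ + ∣ c - v ∣ ≡ m
  ∣-∣-wraparound {a} {c} {v} a<n c<n (s≤s v≤m) e with ≤-total a c
  ... | inj₁ a≤c with wraparound-ends a≤c (≤-pred c<n) e
  ...   | refl , refl = trans (+-comm v _) (∣m-n∣+n≡m v≤m)
  ∣-∣-wraparound {a} {c} {v} a<n c<n (s≤s v≤m) e | inj₂ c≤a with wraparound-ends c≤a (≤-pred a<n) (trans (∣-∣-comm c a) e)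
  ...   | refl , refl = ∣m-n∣+n≡m v≤m

  CycleAdjacent : ℕ → ℕ → Set
  CycleAdjacent a c = ∣ a - c ∣ ≡ 1 ⊎ ∣ a - c ∣ ≡ m

  -- The hypotheses say that the shorter way from a to b crosses the edge {0, m}.
  cdist-step-around : ∀ a b d → a < n → d + ∣ a - b ∣ ≡ m → suc d < ∣ a - b ∣ →
    ∃ λ c → c < n × CycleAdjacent a c × cdist c b ≡ d
  cdist-step-around a b d a<n d+e≡m 1+d<e with <-cmp a b
  ... | tri≈ _ refl _ = contradiction (subst (suc d <_) (∣n-n∣≡0 a) 1+d<e) λ ()
  cdist-step-around zero b d a<n d+e≡m 1+d<e | tri< _ _ _ =
    m , ≤-refl , inj₂ refl , trans (cong arc ∣m-b∣≡d) (arc-d d+e≡m 1+d<e)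
    where
    ∣m-b∣≡d : ∣ m - b ∣ ≡ d
    ∣m-b∣≡d = trans (cong ∣_- b ∣ (trans (sym d+e≡m) (+-comm d b))) (trans (∣-∣-comm (b + d) b) (∣m-m+n∣≡n b d))
  cdist-step-around (suc a) b d a<n d+e≡m 1+d<e | tri< a<b _ _ =
    a , <-trans (n<1+n a) a<n , inj₁ (∣1+m-m∣≡1 a) , trans (cong arc ∣a-b∣≡1+e) (arc-1+e d+e≡m 1+d<e)
    where
    ∣a-b∣≡1+e : ∣ a - b ∣ ≡ suc ∣ suc a - b ∣
    ∣a-b∣≡1+e = +-cancelʳ-≡ a _ _ (trans (∣m-n∣+m≡n (≤-trans (n≤1+n a) (<⇒≤ a<b)))
                 (trans (sym (∣m-n∣+m≡n (<⇒≤ a<b))) (+-suc _ a)))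
  ... | tri> _ _ b<a with m≤n⇒m<n∨m≡n a<n
  ...   | inj₁ 1+a<n = suc a , 1+a<n , inj₁ (∣m-1+m∣≡1 a) , trans (cong arc ∣1+a-b∣≡1+e) (arc-1+e d+e≡m 1+d<e)
    where
    ∣1+a-b∣≡1+e : ∣ suc a - b ∣ ≡ suc ∣ a - b ∣
    ∣1+a-b∣≡1+e = +-cancelʳ-≡ b _ _
      (trans (∣m-n∣+n≡m (≤-trans (<⇒≤ b<a) (n≤1+n a))) (cong suc (sym (∣m-n∣+n≡m (<⇒≤ b<a)))))
  ...   | inj₂ refl = 0 , s≤s z≤n , inj₂ (∣-∣-identityʳ m) , trans (cong arc b≡d) (arc-d d+e≡m 1+d<e)
    where
    b≡d : b ≡ d
    b≡d = +-cancelˡ-≡ ∣ m - b ∣ b d (trans (∣m-n∣+n≡m (<⇒≤ b<a)) (trans (sym d+e≡m) (+-comm d _)))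

  cdist-step : ∀ a b d → a < n → b < n → cdist a b ≡ suc d → ∃ λ c → c < n × CycleAdjacent a c × cdist c b ≡ d
  cdist-step a b d a<n b<n h with ∣ a - b ∣ ≤? n ∸ ∣ a - b ∣
  ... | yes short =
    let c , c≤ , ∣a-c∣≡1 , ∣c-b∣≡d = ∣-∣-step a b d ∣a-b∣≡1+d
    in c , ≤-<-trans c≤ (⊔-lub a<n b<n) , inj₁ ∣a-c∣≡1 , (begin-equality
      arc ∣ c - b ∣   ≡⟨ cong arc ∣c-b∣≡d ⟩
      d ⊓ (n ∸ d)     ≡⟨ m≤n⇒m⊓n≡m d≤n∸d ⟩
      d               ∎)
    where
    open ≤-Reasoning
    ∣a-b∣≡1+d : ∣ a - b ∣ ≡ suc d
    ∣a-b∣≡1+d = trans (sym (m≤n⇒m⊓n≡m short)) h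
    d≤n∸d : d ≤ n ∸ d
    d≤n∸d = begin
      d                     ≤⟨ n≤1+n d ⟩
      suc d                 ≡⟨ ∣a-b∣≡1+d ⟨
      ∣ a - b ∣             ≤⟨ short ⟩
      n ∸ ∣ a - b ∣         ≤⟨ ∸-monoʳ-≤ n (≤-trans (n≤1+n d) (≤-reflexive (sym ∣a-b∣≡1+d))) ⟩
      n ∸ d                 ∎
  ... | no long = cdist-step-around a b d a<n (suc-injective 1+d+e≡n) (subst (_< ∣ a - b ∣) n∸e≡1+d (≰⇒> long))
    where
    n∸e≡1+d : n ∸ ∣ a - b ∣ ≡ suc d
    n∸e≡1+d = trans (sym (m≥n⇒m⊓n≡n (<⇒≤ (≰⇒> long)))) h
    1+d+e≡n : suc d + ∣ a - b ∣ ≡ n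
    1+d+e≡n = trans (cong (_+ ∣ a - b ∣) (sym n∸e≡1+d)) (m∸n+n≡m (<⇒≤ (∣-∣<n a<n b<n)))

  -- Ahead s d a and Behind s d a say a ≡ s + d and a + d ≡ s modulo n, for a, s, d < n.
  Ahead : ℕ → ℕ → ℕ → Set
  Ahead s d a = a ≡ s + d ⊎ a + n ≡ s + d

  Behind : ℕ → ℕ → ℕ → Set
  Behind s d a = a + d ≡ s ⊎ a + d ≡ s + n

  ahead-or-behind : ∀ {a s d} → a < n → s < n → cdist a s ≡ d → Ahead s d a ⊎ Behind s d a
  ahead-or-behind {a} {s} {d} a<n s<n h with ⊓-sel ∣ a - s ∣ (n ∸ ∣ a - s ∣) | ≤-total a s
  ... | inj₁ q | inj₂ s≤a = inj₁ (inj₁ (begin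
    a                      ≡⟨ ∣m-n∣+n≡m s≤a ⟨
    ∣ a - s ∣ + s          ≡⟨ +-comm _ s ⟩
    s + ∣ a - s ∣          ≡⟨ cong (s +_) (trans (sym q) h) ⟩
    s + d                  ∎))
    where open ≡-Reasoning
  ... | inj₂ q | inj₁ a≤s = inj₁ (inj₂ (begin
    a + n                                   ≡⟨ cong (a +_) (m+[n∸m]≡n (<⇒≤ (∣-∣<n a<n s<n))) ⟨
    a + (∣ a - s ∣ + (n ∸ ∣ a - s ∣))       ≡⟨ x∙yz≈yx∙z a ∣ a - s ∣ (n ∸ ∣ a - s ∣) ⟩
    ∣ a - s ∣ + a + (n ∸ ∣ a - s ∣)         ≡⟨ cong₂ _+_ (∣m-n∣+m≡n a≤s) (trans (sym q) h) ⟩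
    s + d                                   ∎))
    where
    open ≡-Reasoning
  ... | inj₁ q | inj₁ a≤s = inj₂ (inj₁ (trans (+-comm a d) (trans (cong (_+ a) (trans (sym h) q)) (∣m-n∣+m≡n a≤s))))
  ... | inj₂ q | inj₂ s≤a = inj₂ (inj₂ (begin
    a + d                                   ≡⟨ cong₂ _+_ (sym (∣m-n∣+n≡m s≤a)) (trans (sym h) q) ⟩
    ∣ a - s ∣ + s + (n ∸ ∣ a - s ∣)         ≡⟨ xy∙z≈y∙xz ∣ a - s ∣ s (n ∸ ∣ a - s ∣) ⟩
    s + (∣ a - s ∣ + (n ∸ ∣ a - s ∣))       ≡⟨ cong (s +_) (m+[n∸m]≡n (<⇒≤ (∣-∣<n a<n s<n))) ⟩
    s + n                                   ∎))
    where
    open ≡-Reasoning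

  -- a + b ≡ 2s (mod n), for a, b, s < n.
  IsMidpoint : ℕ → ℕ → ℕ → Set
  IsMidpoint a b s = a + b ≡ s + s ⊎ a + b ≡ s + s + n ⊎ a + b + n ≡ s + s

  offsets-add : ∀ a b s d i j → a + i ≡ s + d → b + d ≡ s + j → a + b + i ≡ s + s + j
  offsets-add a b s d i j e₁ e₂ = +-cancelʳ-≡ d _ _ (begin
    a + b + i + d         ≡⟨ shuffle₁ a b i d ⟩
    (a + i) + (b + d)     ≡⟨ cong₂ _+_ e₁ e₂ ⟩
    (s + d) + (s + j)     ≡⟨ shuffle₂ s d j ⟩
    s + s + j + d         ∎)
    where
    open ≡-Reasoning
    shuffle₁ : ∀ a b i d → a + b + i + d ≡ (a + i) + (b + d)
    shuffle₁ = solve-∀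
    shuffle₂ : ∀ s d j → (s + d) + (s + j) ≡ s + s + j + d
    shuffle₂ = solve-∀

  ahead-behind⇒midpoint : ∀ {a b s d} → Ahead s d a → Behind s d b → IsMidpoint a b s
  ahead-behind⇒midpoint {a} {b} {s} {d} (inj₁ e₁) (inj₁ e₂) =
    inj₁ (trans (sym (+-identityʳ _))
      (trans (offsets-add a b s d 0 0 (trans (+-identityʳ a) e₁) (trans e₂ (sym (+-identityʳ s)))) (+-identityʳ _)))
  ahead-behind⇒midpoint {a} {b} {s} {d} (inj₁ e₁) (inj₂ e₂) =
    inj₂ (inj₁ (trans (sym (+-identityʳ _)) (offsets-add a b s d 0 n (trans (+-identityʳ a) e₁) e₂)))
  ahead-behind⇒midpoint {a} {b} {s} {d} (inj₂ e₁) (inj₁ e₂) =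
    inj₂ (inj₂ (trans (offsets-add a b s d n 0 e₁ (trans e₂ (sym (+-identityʳ s)))) (+-identityʳ _)))
  ahead-behind⇒midpoint {a} {b} {s} {d} (inj₂ e₁) (inj₂ e₂) = inj₁ (+-cancelʳ-≡ n _ _ (offsets-add a b s d n n e₁ e₂))

  ≢+n : ∀ {a x} → a < n → a ≢ x + n
  ≢+n {a} {x} a<n e = <⇒≱ a<n (≤-trans (m≤n+m n x) (≤-reflexive (sym e)))

  ahead-unique : ∀ {a b s d} → a < n → b < n → Ahead s d a → Ahead s d b → a ≡ b
  ahead-unique a<n b<n (inj₁ e₁) (inj₁ e₂) = trans e₁ (sym e₂)
  ahead-unique a<n b<n (inj₂ e₁) (inj₂ e₂) = +-cancelʳ-≡ n _ _ (trans e₁ (sym e₂))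
  ahead-unique a<n b<n (inj₁ e₁) (inj₂ e₂) = contradiction (trans e₁ (sym e₂)) (≢+n a<n)
  ahead-unique a<n b<n (inj₂ e₁) (inj₁ e₂) = contradiction (trans e₂ (sym e₁)) (≢+n b<n)

  behind-unique : ∀ {a b s d} → a < n → b < n → Behind s d a → Behind s d b → a ≡ b
  behind-unique {d = d} a<n b<n (inj₁ e₁) (inj₁ e₂) = +-cancelʳ-≡ d _ _ (trans e₁ (sym e₂))
  behind-unique {d = d} a<n b<n (inj₂ e₁) (inj₂ e₂) = +-cancelʳ-≡ d _ _ (trans e₁ (sym e₂))
  behind-unique {a} {b} {d = d} a<n b<n (inj₁ e₁) (inj₂ e₂) =
    contradiction (+-cancelʳ-≡ d _ _ (trans e₂ (trans (cong (_+ n) (sym e₁)) (xy∙z≈xz∙y a d n)))) (≢+n b<n)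
  behind-unique {a} {b} {d = d} a<n b<n (inj₂ e₁) (inj₁ e₂) =
    contradiction (+-cancelʳ-≡ d _ _ (trans e₁ (trans (cong (_+ n) (sym e₂)) (xy∙z≈xz∙y b d n)))) (≢+n a<n)

  midpoint-comm : ∀ {a b s} → IsMidpoint b a s → IsMidpoint a b s
  midpoint-comm {a} {b} {s} = subst (λ x → x ≡ s + s ⊎ x ≡ s + s + n ⊎ x + n ≡ s + s) (+-comm b a)

  equidistant⇒midpoint : ∀ {a b s} → a < n → b < n → s < n → a ≢ b → cdist a s ≡ cdist b s → IsMidpoint a b s
  equidistant⇒midpoint {a} {b} {s} a<n b<n s<n a≢b h
    with ahead-or-behind a<n s<n h | ahead-or-behind b<n s<n refl
  ... | inj₁ ahead  | inj₂ behind = ahead-behind⇒midpoint {a} {b} {s} ahead behind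
  ... | inj₂ behind | inj₁ ahead  = midpoint-comm {a} {b} {s} (ahead-behind⇒midpoint {b} {a} {s} ahead behind)
  ... | inj₁ ahead  | inj₁ ahead′  = contradiction (ahead-unique {s = s} a<n b<n ahead ahead′) a≢b
  ... | inj₂ behind | inj₂ behind′ = contradiction (behind-unique {s = s} a<n b<n behind behind′) a≢b

  -- 2s ≡ 2t + n, i.e. s and t are antipodal on a cycle of even length, without halving n.
  Antipodal : ℕ → ℕ → Set
  Antipodal s t = s + s ≡ t + t + n ⊎ t + t ≡ s + s + n

  double+n : ∀ x → x + x + n + n ≡ (x + n) + (x + n)
  double+n = solve-∀

  midpoints-antipodal : ∀ {a b s t} → s < n → t < n → s ≢ t → IsMidpoint a b s → IsMidpoint a b t → Antipodal s t
  midpoints-antipodal s<n t<n s≢t (inj₁ p)        (inj₁ q)        = contradiction (m+m-injective (trans (sym p) q)) s≢t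
  midpoints-antipodal s<n t<n s≢t (inj₁ p)        (inj₂ (inj₁ q)) = inj₁ (trans (sym p) q)
  midpoints-antipodal s<n t<n s≢t (inj₁ p)        (inj₂ (inj₂ q)) = inj₂ (trans (sym q) (cong (_+ n) p))
  midpoints-antipodal s<n t<n s≢t (inj₂ (inj₁ p)) (inj₁ q)        = inj₂ (trans (sym q) p)
  midpoints-antipodal s<n t<n s≢t (inj₂ (inj₁ p)) (inj₂ (inj₁ q)) =
    contradiction (m+m-injective (+-cancelʳ-≡ n _ _ (trans (sym p) q))) s≢t
  midpoints-antipodal {s = s} {t} s<n t<n s≢t (inj₂ (inj₁ p)) (inj₂ (inj₂ q)) =
    contradiction (m+m-injective {t} {s + n} (trans (sym q) (trans (cong (_+ n) p) (double+n s)))) (≢+n t<n)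
  midpoints-antipodal s<n t<n s≢t (inj₂ (inj₂ p)) (inj₁ q)        = inj₁ (trans (sym p) (cong (_+ n) q))
  midpoints-antipodal {s = s} {t} s<n t<n s≢t (inj₂ (inj₂ p)) (inj₂ (inj₁ q)) =
    contradiction (m+m-injective {s} {t + n} (trans (sym p) (trans (cong (_+ n) q) (double+n t)))) (≢+n s<n)
  midpoints-antipodal s<n t<n s≢t (inj₂ (inj₂ p)) (inj₂ (inj₂ q)) = contradiction (m+m-injective (trans (sym p) q)) s≢t

  antipode-unique : ∀ {s t u} → t < n → u < n → t ≢ u → Antipodal s t → Antipodal s u → ⊥
  antipode-unique t<n u<n t≢u (inj₁ p) (inj₁ q) = t≢u (m+m-injective (+-cancelʳ-≡ n _ _ (trans (sym p) q)))
  antipode-unique {t = t} {u} t<n u<n t≢u (inj₁ p) (inj₂ q) =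
    ≢+n u<n (m+m-injective {u} {t + n} (trans q (trans (cong (_+ n) p) (double+n t))))
  antipode-unique {t = t} {u} t<n u<n t≢u (inj₂ p) (inj₁ q) =
    ≢+n t<n (m+m-injective {t} {u + n} (trans p (trans (cong (_+ n) q) (double+n u))))
  antipode-unique t<n u<n t≢u (inj₂ p) (inj₂ q) = t≢u (m+m-injective (trans p (sym q)))

  even-gap⇒even : ∀ s t → s + s ≡ t + t + n → parity n ≡ 0ℙ
  even-gap⇒even s t p = begin
    parity n                    ≡⟨ cong (_+ℙ parity n) (parity-double t) ⟨
    parity (t + t) +ℙ parity n  ≡⟨ ℙ.+-homo-+ (t + t) n ⟨
    parity (t + t + n)          ≡⟨ cong parity p ⟨
    parity (s + s)              ≡⟨ parity-double s ⟩
    0ℙ                          ∎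
    where open ≡-Reasoning

  antipodal⇒even : ∀ {s t} → Antipodal s t → parity n ≡ 0ℙ
  antipodal⇒even {s} {t} (inj₁ p) = even-gap⇒even s t p
  antipodal⇒even {s} {t} (inj₂ p) = even-gap⇒even t s p

  module _ (n-even : parity n ≡ 0ℙ) where

    parity-+n : ∀ x → parity (x + n) ≡ parity x
    parity-+n x = trans (ℙ.+-homo-+ x n) (trans (cong (parity x +ℙ_) n-even) (ℙ.+-identityʳ _))

    parity-cdist : ∀ {a s} → a < n → s < n → parity (cdist a s) ≡ parity a +ℙ parity s
    parity-cdist {a} {s} a<n s<n with ahead-or-behind {a} {s} a<n s<n refl
    ... | inj₁ (inj₁ e) = parity-shift (parity s) _ (trans (cong parity e) (ℙ.+-homo-+ s _))
    ... | inj₁ (inj₂ e) = parity-shift (parity s) _ (trans (sym (parity-+n a)) (trans (cong parity e) (ℙ.+-homo-+ s _)))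
    ... | inj₂ (inj₁ e) = trans (parity-shift (parity a) _ (trans (cong parity (sym e)) (ℙ.+-homo-+ a _))) (ℙ.+-comm (parity s) _)
    ... | inj₂ (inj₂ e) = trans (parity-shift (parity a) _ (trans (sym (parity-+n s)) (trans (cong parity (sym e)) (ℙ.+-homo-+ a _))))
                                (ℙ.+-comm (parity s) _)

    parity-Δ : ∀ {x y s} → x < n → y < n → s < n → parity ∣ cdist x s - cdist y s ∣ ≡ parity x +ℙ parity y
    parity-Δ {x} {y} {s} x<n y<n s<n = begin
      parity ∣ cdist x s - cdist y s ∣                   ≡⟨ parity-∣-∣ (cdist x s) (cdist y s) ⟩
      parity (cdist x s) +ℙ parity (cdist y s)           ≡⟨ cong₂ _+ℙ_ (parity-cdist x<n s<n) (parity-cdist y<n s<n) ⟩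
      (parity x +ℙ parity s) +ℙ (parity y +ℙ parity s)   ≡⟨ cancel (parity x) (parity y) (parity s) ⟩
      parity x +ℙ parity y                               ∎
      where
      open ≡-Reasoning
      cancel : ∀ p q r → (p +ℙ r) +ℙ (q +ℙ r) ≡ p +ℙ q
      cancel 0ℙ 0ℙ 0ℙ = refl
      cancel 0ℙ 0ℙ 1ℙ = refl
      cancel 0ℙ 1ℙ 0ℙ = refl
      cancel 0ℙ 1ℙ 1ℙ = refl
      cancel 1ℙ 0ℙ 0ℙ = refl
      cancel 1ℙ 0ℙ 1ℙ = refl
      cancel 1ℙ 1ℙ 0ℙ = refl
      cancel 1ℙ 1ℙ 1ℙ = refl

module Cycle (m : ℕ) (5≤n : 5 ≤ suc m) where

  open CycleArithmetic m public

  D : Fin n → Fin n → ℕ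
  D u v = cdist (toℕ u) (toℕ v)

  edge⇒adjacent : ∀ u w → cycle n u w ≡ true → CycleAdjacent (toℕ u) (toℕ w)
  edge⇒adjacent u w e with ∣ toℕ u - toℕ w ∣ ≡ᵇ 1 in e₁
  ... | true  = inj₁ (≡ᵇ⇒≡′ e₁)
  ... | false = inj₂ (≡ᵇ⇒≡′ e)

  adjacent⇒edge : ∀ u w → CycleAdjacent (toℕ u) (toℕ w) → cycle n u w ≡ true
  adjacent⇒edge u w (inj₁ p) rewrite ≡⇒≡ᵇ′ p = refl
  adjacent⇒edge u w (inj₂ p) rewrite ≡⇒≡ᵇ′ p = ∨-zeroʳ _

  edge-sym : ∀ u w → cycle n u w ≡ true → cycle n w u ≡ true
  edge-sym u w e = adjacent⇒edge w u (Data.Sum.map flip flip (edge⇒adjacent u w e))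
    where
    flip : ∀ {k} → ∣ toℕ u - toℕ w ∣ ≡ k → ∣ toℕ w - toℕ u ∣ ≡ k
    flip = trans (∣-∣-comm (toℕ w) (toℕ u))

  isDistance : IsDistance (cycle n) D
  isDistance = record
    { D≡0⇒≡   = λ u v → toℕ-injective ∘ cdist≡0⇒≡ (toℕ<n u) (toℕ<n v)
    ; D-refl  = cdist-refl ∘ toℕ
    ; D-edge  = D-edge
    ; D-step  = D-step
    ; D-bound = λ u v → cdist<n (toℕ<n u) (toℕ<n v)
    }
    where
    D-edge : ∀ u w v → cycle n u w ≡ true → D u v ≤ suc (D w v)
    D-edge u w v e with edge⇒adjacent u w e
    ... | inj₁ ∣u-w∣≡1 = arc-step _ _
      (subst (λ z → ∣ toℕ u - toℕ v ∣ ≤ z + ∣ toℕ w - toℕ v ∣) ∣u-w∣≡1 (∣-∣-triangle (toℕ u) (toℕ w) (toℕ v)))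
      (subst (λ z → ∣ toℕ w - toℕ v ∣ ≤ z + ∣ toℕ u - toℕ v ∣) (trans (∣-∣-comm (toℕ w) (toℕ u)) ∣u-w∣≡1)
        (∣-∣-triangle (toℕ w) (toℕ u) (toℕ v)))
    ... | inj₂ ∣u-w∣≡m = arc-complement _ _ (∣-∣-wraparound (toℕ<n u) (toℕ<n w) (toℕ<n v) ∣u-w∣≡m)
    D-step : ∀ u v d → D u v ≡ suc d → ∃ λ w → cycle n u w ≡ true × D w v ≡ d
    D-step u v d e =
      let c , c<n , adjacent , cdist≡d = cdist-step (toℕ u) (toℕ v) d (toℕ<n u) (toℕ<n v) e
          toℕ-w = toℕ-fromℕ< c<n
      in fromℕ< c<n , adjacent⇒edge u (fromℕ< c<n) (subst (CycleAdjacent (toℕ u)) (sym toℕ-w) adjacent)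
                    , trans (cong (λ z → cdist z (toℕ v)) toℕ-w) cdist≡d

  Δ≡0⇒midpoint : ∀ x y s → x ≢ y → Δ D x y s ≡ 0 → IsMidpoint (toℕ x) (toℕ y) (toℕ s)
  Δ≡0⇒midpoint x y s x≢y Δ≡0 =
    equidistant⇒midpoint (toℕ<n x) (toℕ<n y) (toℕ<n s) (x≢y ∘ toℕ-injective) (∣m-n∣≡0⇒m≡n Δ≡0)

  zeros-antipodal : ∀ x y s t → x ≢ y → s ≢ t → Δ D x y s ≡ 0 → Δ D x y t ≡ 0 → Antipodal (toℕ s) (toℕ t)
  zeros-antipodal x y s t x≢y s≢t Δs≡0 Δt≡0 =
    midpoints-antipodal {toℕ x} {toℕ y} (toℕ<n s) (toℕ<n t) (s≢t ∘ toℕ-injective)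
      (Δ≡0⇒midpoint x y s x≢y Δs≡0) (Δ≡0⇒midpoint x y t x≢y Δt≡0)

  module _ {c} (x y : Fin n) (x≢y : x ≢ y) (nonzero⇒≥c : ∀ s → Δ D x y s ≢ 0 → c ≤ Δ D x y s) where

    one-of-two : ∀ s t → s ≢ t → ¬ Antipodal (toℕ s) (toℕ t) → c ≤ Δ D x y s ⊎ c ≤ Δ D x y t
    one-of-two s t s≢t not-antipodal with Δ D x y s ≟ℕ 0 | Δ D x y t ≟ℕ 0
    ... | no Δs≢0  | _        = inj₁ (nonzero⇒≥c s Δs≢0)
    ... | yes _    | no Δt≢0  = inj₂ (nonzero⇒≥c t Δt≢0)
    ... | yes Δs≡0 | yes Δt≡0 = contradiction (zeros-antipodal x y s t x≢y s≢t Δs≡0 Δt≡0) not-antipodal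

    one-of-three : ∀ s t u → s ≢ t → s ≢ u → t ≢ u → c ≤ Δ D x y s ⊎ c ≤ Δ D x y t ⊎ c ≤ Δ D x y u
    one-of-three s t u s≢t s≢u t≢u with Δ D x y s ≟ℕ 0 | Δ D x y t ≟ℕ 0 | Δ D x y u ≟ℕ 0
    ... | no Δs≢0  | _        | _        = inj₁ (nonzero⇒≥c s Δs≢0)
    ... | yes _    | no Δt≢0  | _        = inj₂ (inj₁ (nonzero⇒≥c t Δt≢0))
    ... | yes _    | yes _    | no Δu≢0  = inj₂ (inj₂ (nonzero⇒≥c u Δu≢0))
    ... | yes Δs≡0 | yes Δt≡0 | yes Δu≡0 = contradiction
      (zeros-antipodal x y s u x≢y s≢u Δs≡0 Δu≡0)
      (antipode-unique {toℕ s} (toℕ<n t) (toℕ<n u) (t≢u ∘ toℕ-injective) (zeros-antipodal x y s t x≢y s≢t Δs≡0 Δt≡0))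

  small⇒not-antipodal : ∀ {s t} → s + s < n → t + t < n → ¬ Antipodal s t
  small⇒not-antipodal {s} {t} 2s<n 2t<n (inj₁ p) = <⇒≱ 2s<n (≤-trans (m≤n+m n (t + t)) (≤-reflexive (sym p)))
  small⇒not-antipodal {s} {t} 2s<n 2t<n (inj₂ p) = <⇒≱ 2t<n (≤-trans (m≤n+m n (s + s)) (≤-reflexive (sym p)))

  4≤m : 4 ≤ m
  4≤m = ≤-pred 5≤n

  1<n : 1 < n
  1<n = s≤s (≤-trans (s≤s z≤n) 4≤m)

  v₀ v₁ : Fin n
  v₀ = zero
  v₁ = fromℕ< 1<n

  v₀≢v₁ : v₀ ≢ v₁
  v₀≢v₁ e = 0≢1+n (trans (cong toℕ e) (toℕ-fromℕ< 1<n))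

  v₀v₁ : cycle n v₀ v₁ ≡ true
  v₀v₁ = adjacent⇒edge v₀ v₁ (inj₁ (cong (∣ 0 -_∣) (toℕ-fromℕ< 1<n)))

  adjacent⇒≢ : ∀ b c → CycleAdjacent b c → b ≢ c
  adjacent⇒≢ b c (inj₁ p) refl = contradiction (trans (sym (∣n-n∣≡0 b)) p) λ ()
  adjacent⇒≢ b c (inj₂ p) refl = contradiction (trans (sym (∣n-n∣≡0 b)) p) (<⇒≢ (≤-trans (s≤s z≤n) 4≤m))

  adjacent⇒cdist≡1 : ∀ x a → CycleAdjacent x a → cdist x a ≡ 1
  adjacent⇒cdist≡1 x a (inj₁ p) rewrite p = m≤n⇒m⊓n≡m (≤-trans (s≤s z≤n) 4≤m)
  adjacent⇒cdist≡1 x a (inj₂ p) rewrite p | m+n∸n≡m 1 m = m≥n⇒m⊓n≡n (≤-trans (s≤s z≤n) 4≤m)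

  neighbour-indices : ∀ a → a < n → ∃ λ b → ∃ λ c → b < n × c < n × b ≢ c × CycleAdjacent b a × CycleAdjacent c a
  neighbour-indices zero _ =
    1 , m , 1<n , ≤-refl , (λ 1≡m → <⇒≢ (≤-trans (s≤s (s≤s z≤n)) 4≤m) 1≡m) , inj₁ refl , inj₂ (∣-∣-identityʳ m)
  neighbour-indices (suc a) 1+a<n with suc a <? m
  ... | yes 1+a<m = suc (suc a) , a , s≤s 1+a<m , <-trans (n<1+n a) 1+a<n ,
                    (λ e → <⇒≢ (<-trans (n<1+n a) (n<1+n (suc a))) (sym e)) ,
                    inj₁ (∣1+m-m∣≡1 (suc a)) , inj₁ (∣m-1+m∣≡1 a)
  ... | no 1+a≮m = 0 , a , s≤s z≤n , <-trans (n<1+n a) 1+a<n , (λ 0≡a → <⇒≢ 0<a 0≡a) ,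
                   inj₂ 1+a≡m , inj₁ (∣m-1+m∣≡1 a)
    where
    1+a≡m : suc a ≡ m
    1+a≡m = ≤-antisym (≤-pred 1+a<n) (≮⇒≥ 1+a≮m)
    0<a : 0 < a
    0<a = ≤-pred (≤-trans (≤-trans (s≤s (s≤s z≤n)) 4≤m) (≤-reflexive (sym 1+a≡m)))

  equidistant-neighbours : ∀ s → ∃ λ x → ∃ λ y → x ≢ y × Δ D x y s ≡ 0
  equidistant-neighbours s =
    let b , c , b<n , c<n , b≢c , b~s , c~s = neighbour-indices (toℕ s) (toℕ<n s)
    in fromℕ< b<n , fromℕ< c<n , (λ e → b≢c (trans (sym (toℕ-fromℕ< b<n)) (trans (cong toℕ e) (toℕ-fromℕ< c<n)))) ,
       m≡n⇒∣m-n∣≡0 (trans (cdist-at b b<n b~s) (sym (cdist-at c c<n c~s)))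
    where
    cdist-at : ∀ b (b<n : b < n) → CycleAdjacent b (toℕ s) → D (fromℕ< b<n) s ≡ 1
    cdist-at b b<n b~s = trans (cong (λ z → cdist z (toℕ s)) (toℕ-fromℕ< b<n)) (adjacent⇒cdist≡1 b (toℕ s) b~s)

  2≤n : 2 ≤ n
  2≤n = ≤-trans (s≤s (s≤s z≤n)) 5≤n

  wdim₁ : IsWDim 1 (cycle n) 2
  wdim₁ = (tabulate P , resolving , trans (∣tabulate∣≡count P) (count-<ᵇ n 2 2≤n)) , minimal
    where
    P : Fin n → Bool
    P i = toℕ i <ᵇ 2
    2s<n : ∀ s → P s ≡ true → toℕ s + toℕ s < n
    2s<n s Ps = ≤-<-trans (+-mono-≤ s≤1 s≤1) (≤-trans (s≤s (s≤s (s≤s z≤n))) 5≤n)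
      where
      s≤1 : toℕ s ≤ 1
      s≤1 = ≤-pred (<ᵇ⇒<′ Ps)
    resolving : WeakResolving 1 (cycle n) (tabulate P)
    resolving x y x≢y = subst (1 ≤_) (sym (ΔS-tabulate isDistance P x y))
      (≤-trans (≤-reflexive (cong (λ c → 1 * (c ∸ 1)) (sym (count-<ᵇ n 2 2≤n))))
        (*-[count∸1]≤∑∈ 1 P (Δ D x y) λ s t Ps Pt s≢t →
          one-of-two x y x≢y (λ _ → n≢0⇒n>0) s t s≢t (small⇒not-antipodal {toℕ s} {toℕ t} (2s<n s Ps) (2s<n t Pt))))
    minimal : ∀ S → WeakResolving 1 (cycle n) S → 2 ≤ ∣ S ∣
    minimal S resolving with ∑∈-positive⇒member (lookup S) (Δ D v₀ v₁)
                               (subst (1 ≤_) (ΔS≡∑∈Δ isDistance S v₀ v₁) (resolving v₀ v₁ v₀≢v₁))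
    ... | s , s∈S with equidistant-neighbours s
    ... | x , y , x≢y , Δs≡0 with ∑∈-positive⇒member (lookup S ─ s) (Δ D x y) (subst (1 ≤_) ΔS≡rest (resolving x y x≢y))
      where
      ΔS≡rest : ΔS (cycle n) S x y ≡ ∑∈ (lookup S ─ s) (Δ D x y)
      ΔS≡rest = trans (ΔS≡∑∈Δ isDistance S x y)
                  (trans (∑∈-remove (lookup S) (Δ D x y) s s∈S) (cong (_+ ∑∈ (lookup S ─ s) (Δ D x y)) Δs≡0))
    ... | t , t∈ = subst (2 ≤_) (sym (trans (∣S∣≡count S) (count-remove (lookup S) s s∈S))) (s≤s (1≤count (lookup S ─ s) t t∈))

  module _ (h : ℕ) (m≡2h : m ≡ h + h) where

    n∸h≡1+h : n ∸ h ≡ suc h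
    n∸h≡1+h = trans (cong (λ z → suc z ∸ h) m≡2h) (trans (cong (_∸ h) (sym (+-suc h h))) (m+n∸m≡n h (suc h)))

    m∸h≡h : m ∸ h ≡ h
    m∸h≡h = trans (cong (_∸ h) m≡2h) (m+n∸m≡n h h)

    cdist≡h : ∀ x a → ∣ x - a ∣ ≡ h ⊎ ∣ x - a ∣ ≡ suc h → cdist x a ≡ h
    cdist≡h x a (inj₁ p) rewrite p | n∸h≡1+h = m≤n⇒m⊓n≡m (n≤1+n h)
    cdist≡h x a (inj₂ p) rewrite p | m∸h≡h   = m≥n⇒m⊓n≡n (n≤1+n h)

    ∣a+k-a∣≡k : ∀ a k → ∣ a + k - a ∣ ≡ k
    ∣a+k-a∣≡k a k = trans (∣-∣-comm (a + k) a) (∣m-m+n∣≡n a k)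

    opposite-edge-indices : ∀ a → a < n →
      ∃ λ b → ∃ λ c → b < n × c < n × CycleAdjacent b c × cdist b a ≡ h × cdist c a ≡ h
    opposite-edge-indices a a<n with <-cmp a h
    ... | tri< a<h _ _ =
      a + h , suc (a + h) , <-trans (n<1+n _) 1+a+h<n , 1+a+h<n , inj₁ (∣m-1+m∣≡1 (a + h)) ,
      cdist≡h (a + h) a (inj₁ (∣a+k-a∣≡k a h)) ,
      cdist≡h (suc (a + h)) a (inj₂ (trans (cong (∣_- a ∣) (sym (+-suc a h))) (∣a+k-a∣≡k a (suc h))))
      where
      1+a+h<n : suc (a + h) < n
      1+a+h<n = s≤s (≤-trans (+-monoˡ-≤ h a<h) (≤-reflexive (sym m≡2h)))
    ... | tri≈ _ refl _ =
      m , 0 , ≤-refl , s≤s z≤n , inj₂ (∣-∣-identityʳ m) ,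
      cdist≡h m a (inj₁ (trans (cong (∣_- a ∣) m≡2h) (∣a+k-a∣≡k a a))) , cdist≡h 0 a (inj₁ refl)
    ... | tri> _ _ h<a =
      a′ , suc a′ , <-trans (n<1+n a′) 1+a′<n , 1+a′<n , inj₁ (∣m-1+m∣≡1 a′) ,
      cdist≡h a′ a (inj₂ (trans (cong (∣ a′ -_∣) a≡a′+1+h) (∣m-m+n∣≡n a′ (suc h)))) ,
      cdist≡h (suc a′) a (inj₁ (trans (cong (∣ suc a′ -_∣) (trans a≡a′+1+h (+-suc a′ h))) (∣m-m+n∣≡n (suc a′) h)))
      where
      a′ = a ∸ suc h
      a≡a′+1+h : a ≡ a′ + suc h
      a≡a′+1+h = sym (m∸n+n≡m h<a)
      1+a′<n : suc a′ < n
      1+a′<n = ≤-<-trans (subst (a′ <_) (sym a≡a′+1+h) (m<m+n a′ (s≤s z≤n))) a<n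

    equidistant-edge : ∀ s → ∃ λ x → ∃ λ y → x ≢ y × cycle n x y ≡ true × Δ D x y s ≡ 0
    equidistant-edge s =
      let b , c , b<n , c<n , b~c , b-s , c-s = opposite-edge-indices (toℕ s) (toℕ<n s)
          toℕ-x = toℕ-fromℕ< b<n
          toℕ-y = toℕ-fromℕ< c<n
      in fromℕ< b<n , fromℕ< c<n ,
         (λ x≡y → adjacent⇒≢ b c b~c (trans (sym toℕ-x) (trans (cong toℕ x≡y) toℕ-y))) ,
         adjacent⇒edge (fromℕ< b<n) (fromℕ< c<n) (subst₂ CycleAdjacent (sym toℕ-x) (sym toℕ-y) b~c) ,
         m≡n⇒∣m-n∣≡0 (trans (cong (λ z → cdist z (toℕ s)) toℕ-x)
                       (trans b-s (sym (trans (cong (λ z → cdist z (toℕ s)) toℕ-y) c-s))))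

  wdim-odd : ¬ 2 ∣ n → ∀ k → 2 ≤ k → k ≤ m → IsWDim k (cycle n) (k + 1)
  wdim-odd odd k 2≤k k≤m = (tabulate P , resolving , trans (∣tabulate∣≡count P) |P|) , minimal
    where
    P : Fin n → Bool
    P i = toℕ i <ᵇ (k + 1)
    |P| : count P ≡ k + 1
    |P| = count-<ᵇ n (k + 1) (subst (_≤ n) (+-comm 1 k) (s≤s k≤m))
    no-antipodes : ∀ s t → ¬ Antipodal s t
    no-antipodes s t anti = odd (parity≡0ℙ⇒2∣ n (antipodal⇒even {s} {t} anti))
    resolving : WeakResolving k (cycle n) (tabulate P)
    resolving x y x≢y = subst (k ≤_) (sym (ΔS-tabulate isDistance P x y))
      (≤-trans (≤-reflexive (trans (sym (m+n∸n≡m k 1)) (trans (cong (_∸ 1) (sym |P|)) (sym (*-identityˡ _)))))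
        (*-[count∸1]≤∑∈ 1 P (Δ D x y) λ s t _ _ s≢t →
          one-of-two x y x≢y (λ _ → n≢0⇒n>0) s t s≢t (no-antipodes (toℕ s) (toℕ t))))
    minimal : ∀ S → WeakResolving k (cycle n) S → k + 1 ≤ ∣ S ∣
    minimal S resolving with ∑∈-positive⇒member (lookup S) (Δ D v₀ v₁)
                               (subst (1 ≤_) (ΔS≡∑∈Δ isDistance S v₀ v₁)
                                 (≤-trans (≤-trans (s≤s z≤n) 2≤k) (resolving v₀ v₁ v₀≢v₁)))
    ... | s , s∈S with odd⇒pred-double m odd
    ... | h , m≡2h with equidistant-edge h m≡2h s
    ... | x , y , x≢y , xy , Δs≡0 = begin
      k + 1                      ≤⟨ +-monoˡ-≤ 1 (resolving x y x≢y) ⟩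
      ΔS (cycle n) S x y + 1     ≡⟨ cong (_+ 1) (ΔS≡∑∈Δ isDistance S x y) ⟩
      ∑∈ (lookup S) (Δ D x y) + 1 ≤⟨ +-monoˡ-≤ 1 (∑∈≤count∸1 (lookup S) (Δ D x y) s s∈S Δs≡0 λ t _ →
                                       edge⇒Δ≤1 isDistance x y xy (edge-sym x y xy) t) ⟩
      count (lookup S) ∸ 1 + 1   ≡⟨ m∸n+n≡m (1≤count (lookup S) s s∈S) ⟩
      count (lookup S)           ≡⟨ ∣S∣≡count S ⟨
      ∣ S ∣                      ∎
      where open ≤-Reasoning

  m≤2*[m∸2] : ∀ m → 4 ≤ m → m ≤ 2 * (m ∸ 2)
  m≤2*[m∸2] (suc (suc j)) (s≤s (s≤s 2≤j)) = ≤-trans (+-monoˡ-≤ j 2≤j) (≤-reflexive (cong (j +_) (sym (+-identityʳ j))))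

  m≤2*[m∸1] : ∀ m → 2 ≤ m → m ≤ 2 * (m ∸ 1)
  m≤2*[m∸1] (suc j) (s≤s 1≤j) = ≤-trans (+-monoˡ-≤ j 1≤j) (≤-reflexive (cong (j +_) (sym (+-identityʳ j))))

  wdim-even : 2 ∣ n → ∀ k → 2 ≤ k → k ≤ n → IsWDim k (cycle n) k
  wdim-even 2∣n k 2≤k k≤n = (tabulate P , resolving , trans (∣tabulate∣≡count P) |P|) , minimal
    where
    P : Fin n → Bool
    P i = toℕ i <ᵇ k
    |P| : count P ≡ k
    |P| = count-<ᵇ n k k≤n
    n-even : parity n ≡ 0ℙ
    n-even = 2∣⇒parity≡0ℙ 2∣n
    even-nonzero⇒≥2 : ∀ v → parity v ≡ 0ℙ → v ≢ 0 → 2 ≤ v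
    even-nonzero⇒≥2 zero          _  v≢0 = contradiction refl v≢0
    even-nonzero⇒≥2 (suc (suc v)) _  _   = s≤s (s≤s z≤n)
    nonzero⇒≥2 : ∀ x y → parity (toℕ x) +ℙ parity (toℕ y) ≡ 0ℙ → ∀ s → Δ D x y s ≢ 0 → 2 ≤ Δ D x y s
    nonzero⇒≥2 x y pxy s = even-nonzero⇒≥2 _ (trans (parity-Δ n-even (toℕ<n x) (toℕ<n y) (toℕ<n s)) pxy)
    bound : ∀ x y → x ≢ y → k ≤ ∑∈ P (Δ D x y)
    bound x y x≢y with parity (toℕ x) +ℙ parity (toℕ y) in pxy
    ... | 1ℙ = subst (_≤ ∑∈ P (Δ D x y)) |P| (count≤∑∈ P (Δ D x y) λ s _ → n≢0⇒n>0 λ Δ≡0 →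
                 contradiction (trans (sym (cong parity Δ≡0)) (trans (parity-Δ n-even (toℕ<n x) (toℕ<n y) (toℕ<n s)) pxy)) λ ())
    ... | 0ℙ with 4 ≤? k
    ...   | yes 4≤k = ≤-trans (m≤2*[m∸2] k 4≤k) (subst (λ c → 2 * (c ∸ 2) ≤ ∑∈ P (Δ D x y)) |P|
                        (*-[count∸2]≤∑∈ 2 P (Δ D x y) λ s t u _ _ _ → one-of-three x y x≢y (nonzero⇒≥2 x y pxy) s t u))
    ...   | no 4≰k  = ≤-trans (m≤2*[m∸1] k 2≤k) (subst (λ c → 2 * (c ∸ 1) ≤ ∑∈ P (Δ D x y)) |P|
                        (*-[count∸1]≤∑∈ 2 P (Δ D x y) λ s t Ps Pt s≢t → one-of-two x y x≢y (nonzero⇒≥2 x y pxy) s t s≢t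
                          (small⇒not-antipodal {toℕ s} {toℕ t} (small s Ps) (small t Pt))))
      where
      small : ∀ s → P s ≡ true → toℕ s + toℕ s < n
      small s Ps = ≤-<-trans (+-mono-≤ s≤2 s≤2) 5≤n
        where
        s≤2 : toℕ s ≤ 2
        s≤2 = ≤-pred (≤-pred (≤-trans (s≤s (<ᵇ⇒<′ Ps)) (≰⇒> 4≰k)))
    resolving : WeakResolving k (cycle n) (tabulate P)
    resolving x y x≢y = subst (k ≤_) (sym (ΔS-tabulate isDistance P x y)) (bound x y x≢y)
    minimal : ∀ S → WeakResolving k (cycle n) S → k ≤ ∣ S ∣
    minimal S = edge⇒k≤∣S∣ isDistance S v₀v₁ (edge-sym v₀ v₁ v₀v₁) v₀≢v₁

at-1-or-2 : {P : ℕ → Set} → (∀ k → 1 ≤ k → k ≤ 2 → P k) → ∀ k → k ≡ 1 ⊎ k ≡ 2 → P k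
at-1-or-2 h k (inj₁ refl) = h 1 ≤-refl (s≤s z≤n)
at-1-or-2 h k (inj₂ refl) = h 2 (s≤s z≤n) ≤-refl

at-3-or-4 : {P : ℕ → Set} → (∀ k → 3 ≤ k → k ≤ 4 → P k) → ∀ k → k ≡ 3 ⊎ k ≡ 4 → P k
at-3-or-4 h k (inj₁ refl) = h 3 ≤-refl (n≤1+n 3)
at-3-or-4 h k (inj₂ refl) = h 4 (n≤1+n 3) ≤-refl

proposition4p2 :
    ((n : ℕ) → 2 ≤ n →
      IsWDim 1 (complete n) (n ∸ 1) × IsWDim 2 (complete n) n)
    × ((n : ℕ) → 5 ≤ n →
      ((k : ℕ) → k ≡ 1 ⊎ k ≡ 2 → IsWDim k (star n) (n ∸ 2))
      × ((k : ℕ) → k ≡ 3 ⊎ k ≡ 4 → IsWDim k (star n) (n ∸ 1)))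
    × ((q r : ℕ) → 2 ≤ q → 2 ≤ r →
      ((k : ℕ) → k ≡ 1 ⊎ k ≡ 2 → IsWDim k (completeBipartite q r) (q + r ∸ 2))
      × ((k : ℕ) → k ≡ 3 ⊎ k ≡ 4 → IsWDim k (completeBipartite q r) (q + r)))
    × ((n : ℕ) → 2 ≤ n → (k : ℕ) → 1 ≤ k → k ≤ n → IsWDim k (path n) k)
    × ((n : ℕ) → 5 ≤ n →
      IsWDim 1 (cycle n) 2
      × (¬ (2 ∣ n) → (k : ℕ) → 2 ≤ k → k ≤ n ∸ 1 → IsWDim k (cycle n) (k + 1))
      × (2 ∣ n → (k : ℕ) → 2 ≤ k → k ≤ n → IsWDim k (cycle n) k))
proposition4p2 =
    (λ { (suc zero) (s≤s ()) ; (suc (suc m)) _ → CompleteGraph.wdim₁ m , CompleteGraph.wdim₂ m })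
  , (λ n 5≤n → Data.Product.map at-1-or-2 at-3-or-4 (star-wdim n 5≤n))
  , (λ q r 2≤q 2≤r → Data.Product.map at-1-or-2 at-3-or-4 (completeBipartite-wdim q r 2≤q 2≤r))
  , Path.wdim
  , λ { (suc m) 5≤n → Cycle.wdim₁ m 5≤n , Cycle.wdim-odd m 5≤n , Cycle.wdim-even m 5≤n }
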